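{- Let $m$ and $n$ be composite integers. Then the proper divisor graphs $\Upsilon_m$ and $\Upsilon_n$ are isomorphic if and only if either $m$ and $n$ are similar, or $\{m,n\}=\{p^3, q_1q_2\}$ for some primes $p,q_1,q_2$ with $q_1\neq q_2$ (in this exceptional case $\Upsilon_m\cong\Upsilon_n$ although $m,n$ are not similar).
   Context: For an integer $n>1$, a proper divisor of $n$ is an integer $d$ with $1<d<n$ and $d\mid n$. The proper divisor graph $\Upsilon_n$ is the simple graph whose vertices are the proper divisors of $n$, two distinct vertices $u,v$ being adjacent iff $n$ divides $uv$. Two positive integers $n=p_1^{\alpha_1}\cdots p_k^{\alpha_k}$ and $m=q_1^{\beta_1}\cdots q_l^{\beta_l}$ (prime power factorizations with distinct primes in each, $\alpha_1\ge\cdots\ge\alpha_k\ge1$, $\beta_1\ge\cdots\ge\beta_l\ge1$) are called similar if $k=l$ and $\alpha_i=\beta_i$ for all $i$. -}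

module Defs where

open import Data.Nat using (ℕ; _*_; _^_; _<_; _≥_; _≤_)
open import Data.Nat.Divisibility using (_∣_)
open import Data.Nat.Primality using (Prime)
open import Data.Product using (Σ; ∃; ∃-syntax; _×_; _,_; proj₁; proj₂)
open import Data.List using (List; map)
open import Data.Nat.ListAction using (product)
open import Data.List.Relation.Unary.All using (All)
open import Data.List.Relation.Unary.AllPairs using (AllPairs)
open import Relation.Binary.PropositionalEquality using (_≡_; _≢_)
open import Relation.Nullary using (¬_)
open import Function.Bundles using (_⤖_; _⇔_; Bijection)

ProperDivisor : ℕ → Set
ProperDivisor n = Σ ℕ λ d → (1 < d) × (d < n) × (d ∣ n)

Adj : (n : ℕ) → ProperDivisor n → ProperDivisor n → Set
Adj n u v = (proj₁ u ≢ proj₁ v) × (n ∣ proj₁ u * proj₁ v)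

_≅Υ_ : ℕ → ℕ → Set
m ≅Υ n = Σ (ProperDivisor m ⤖ ProperDivisor n) λ f →
  ∀ u v → Adj m u v ⇔ Adj n (Bijection.to f u) (Bijection.to f v)

IsFactorization : ℕ → List (ℕ × ℕ) → Set
IsFactorization n fs =
  All (λ pe → Prime (proj₁ pe)) fs ×
  AllPairs (λ a b → proj₁ a ≢ proj₁ b) fs ×
  All (λ pe → 1 ≤ proj₂ pe) fs ×
  AllPairs (λ a b → proj₂ a ≥ proj₂ b) fs ×
  (product (map (λ pe → proj₁ pe ^ proj₂ pe) fs) ≡ n)

Similar : ℕ → ℕ → Set
Similar n m = ∃[ fs ] ∃[ gs ]
  IsFactorization n fs × IsFactorization m gs × (map proj₂ fs ≡ map proj₂ gs)

-- A graph isomorphism Υ m ≅ Υ n preserves the number τ − 2 of vertices, the leaves and the degrees.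
-- When m = p^(a+1) r with p ∤ r and r > 1, the prime p is a leaf whose only neighbour is p^a r, and
-- the only leaves that are not prime are squares s² with m ∈ {s³, s⁴}.  So if both m and n have two
-- prime factors, an isomorphism sends primes to primes, and the degree of p^a r, which is
-- τ(p^a r) − 1 or τ(p^a r) − 2, pins down the exponent a, except when τ m = 6 and both numbers have
-- the shape p² q.  If m = p^(a+1) and n has two prime factors, two prime leaves of Υ n force
-- m ∈ {p³, p⁴}, and then τ n = τ m ≤ 5 leaves only m = p³, n = q₁ q₂.  Conversely, similar numbers
-- are matched by the multiplicative bijection of divisors exchanging corresponding primes, and
-- Υ(p³) and Υ(q₁ q₂) are both a single edge.
module Submission where

open import Data.Empty using (⊥; ⊥-elim)
open import Data.List using (List; []; _∷_; _++_; length; filter; upTo; map)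
open import Data.List.Membership.Propositional using (_∈_)
open import Data.List.Membership.Propositional.Properties
  using (∈-filter⁺; ∈-filter⁻; ∈-upTo⁺; ∈-∃++; ∈-++⁺ˡ; ∈-++⁺ʳ; ∈-++⁻; ∈-map⁺; ∈-map⁻)
open import Data.List.Properties using (length-++; length-map; map-∘; ∷-injective)
open import Data.List.Relation.Binary.Permutation.Propositional using (_↭_; ↭-sym; ↭⇒↭ₛ)
import Data.List.Relation.Binary.Permutation.Propositional.Properties as ↭
import Data.List.Relation.Binary.Permutation.Setoid.Properties as ↭ₛ
open import Data.List.Relation.Binary.Subset.Propositional using (_⊆_)
open import Data.List.Relation.Unary.All as All using (All; []; _∷_)
import Data.List.Relation.Unary.All.Properties as All
open import Data.List.Relation.Unary.AllPairs as AllPairs using (AllPairs; []; _∷_)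
import Data.List.Relation.Unary.AllPairs.Properties as AllPairs
open import Data.List.Relation.Unary.Any using (here; there)
import Data.List.Relation.Unary.Sorted.TotalOrder.Properties as Sorted
open import Data.List.Relation.Unary.Unique.Propositional using (Unique)
import Data.List.Relation.Unary.Unique.Propositional.Properties as Unique
open import Data.Nat
open import Data.Nat.Coprimality using (Coprime; coprime-divisor)
open import Data.Nat.Divisibility
open import Data.Nat.Induction using (<-rec)
open import Data.Nat.ListAction using (product)
open import Data.Nat.Primality
open import Data.Nat.Primality.Factorisation using (factorise)
open import Data.Nat.Properties
open import Algebra.Properties.CommutativeSemigroup *-commutativeSemigroup
  using (x∙yz≈y∙xz; x∙yz≈z∙yx; interchange)
open import Data.Product using (∃; ∃-syntax; _×_; _,_; proj₁; proj₂)
open import Data.Sum using (_⊎_; inj₁; inj₂; [_,_])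
open import Function using (id; _∘_)
open import Function.Bundles using (_⇔_; mk⇔; Bijection; Equivalence; _⤖_)
open import Level using (0ℓ)
open import Relation.Binary.Bundles using (DecTotalOrder)
import Relation.Binary.Construct.Flip.Ord as Flip
import Relation.Binary.Construct.On as On
open import Relation.Binary.Definitions using (tri<; tri≈; tri>)
open import Relation.Binary.PropositionalEquality hiding ([_])
open import Relation.Nullary using (¬_; Dec; yes; no; ¬?; contradiction)
open import Relation.Nullary.Decidable using (_×-dec_)
open import Relation.Unary using (Pred; Decidable)
open import Relation.Unary.Properties using (∁?)

open import Defs

private variable
  a b c d e i j k m n p q r s u w x y z : ℕ
  fs gs : List (ℕ × ℕ)
  Φ Ψ : ℕ → ℕ

prime⇒>1 : Prime p → 1 < p
prime⇒>1 {p} pp = nonTrivial⇒n>1 p {{prime⇒nonTrivial pp}}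

prime⇒>0 : Prime p → 0 < p
prime⇒>0 pp = <⇒≤ (prime⇒>1 pp)

prime∤1 : Prime p → ¬ p ∣ 1
prime∤1 pp p∣1 = <⇒≢ (prime⇒>1 pp) (sym (∣1⇒≡1 p∣1))

prime∣prime⇒≡ : Prime p → Prime q → p ∣ q → p ≡ q
prime∣prime⇒≡ pp pq p∣q with prime⇒irreducible pq p∣q
... | inj₁ refl = ⊥-elim (prime∤1 pp ∣-refl)
... | inj₂ p≡q  = p≡q

prime∣prime^⇒≡ : ∀ a → Prime p → Prime q → p ∣ q ^ a → p ≡ q
prime∣prime^⇒≡ zero    pp pq p∣1 = ⊥-elim (prime∤1 pp p∣1)
prime∣prime^⇒≡ {q = q} (suc a) pp pq p∣q^1+a with euclidsLemma q (q ^ a) pp p∣q^1+a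
... | inj₁ p∣q   = prime∣prime⇒≡ pp pq p∣q
... | inj₂ p∣q^a = prime∣prime^⇒≡ a pp pq p∣q^a

prime∤* : Prime p → ¬ p ∣ x → ¬ p ∣ y → ¬ p ∣ x * y
prime∤* {x = x} {y} pp p∤x p∤y p∣xy with euclidsLemma x y pp p∣xy
... | inj₁ p∣x = p∤x p∣x
... | inj₂ p∣y = p∤y p∣y

prime∤∧∣p^a*r⇒∣r : ∀ a → Prime p → ¬ p ∣ d → d ∣ p ^ a * r → d ∣ r
prime∤∧∣p^a*r⇒∣r {r = r} zero pp p∤d d∣r = subst (_ ∣_) (*-identityˡ r) d∣r
prime∤∧∣p^a*r⇒∣r {p} {d} {r} (suc a) pp p∤d d∣ =
  prime∤∧∣p^a*r⇒∣r a pp p∤d (coprime-divisor d⊥p (subst (d ∣_) (*-assoc p (p ^ a) r) d∣))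
  where
  d⊥p : Coprime d p
  d⊥p (i∣d , i∣p) with prime⇒irreducible pp i∣p
  ... | inj₁ i≡1  = i≡1
  ... | inj₂ refl = ⊥-elim (p∤d i∣d)

∣⇒>0 : 0 < n → d ∣ n → 0 < d
∣⇒>0 {d = zero}  n>0 0∣n = contradiction (0∣⇒≡0 0∣n) (>⇒≢ n>0)
∣⇒>0 {d = suc d} _   _   = z<s

∤⇒>0 : ¬ p ∣ r → 0 < r
∤⇒>0 {r = zero}  p∤0 = contradiction (divides 0 refl) p∤0
∤⇒>0 {r = suc r} _   = z<s

m*n>0 : 0 < x → 0 < y → 0 < x * y
m*n>0 {suc x} {suc y} _ _ = z<s

m<n*m : ∀ m n .{{_ : NonZero m}} → 1 < n → m < n * m
m<n*m m n 1<n = subst (m <_) (*-comm m n) (m<m*n m n 1<n)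

^-monoʳ-∣ : ∀ p → i ≤ j → p ^ i ∣ p ^ j
^-monoʳ-∣ {i} {j} p i≤j =
  divides (p ^ (j ∸ i)) (trans (cong (p ^_) (sym (m∸n+n≡m i≤j))) (^-distribˡ-+-* p (j ∸ i) i))

p^a≢0 : ∀ a → Prime p → NonZero (p ^ a)
p^a≢0 {p} a pp = m^n≢0 p a {{prime⇒nonZero pp}}

p^a*r>0 : ∀ a → Prime p → ¬ p ∣ r → 0 < p ^ a * r
p^a*r>0 {p} a pp p∤r = m*n>0 (m^n>0 p {{prime⇒nonZero pp}} a) (∤⇒>0 p∤r)

1<p^1+a : ∀ a → Prime p → 1 < p ^ suc a
1<p^1+a {p} a pp = ≤-trans (prime⇒>1 pp) (m≤m*n p (p ^ a) {{p^a≢0 a pp}})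

primeFactor : 1 < n → ∃[ p ] Prime p × p ∣ n
primeFactor {n} 1<n with factorise n {{>-nonZero (<⇒≤ 1<n)}}
... | record { factors = [] ; isFactorisation = n≡1 } = contradiction n≡1 (>⇒≢ 1<n)
... | record { factors = p ∷ ps ; isFactorisation = n≡p*ps ; factorsPrime = pp ∷ _ } =
  p , pp , divides (product ps) (trans n≡p*ps (*-comm p (product ps)))

ExactPower : ℕ → ℕ → ℕ → Set
ExactPower p a n = ∃[ r ] n ≡ p ^ a * r × ¬ p ∣ r

exactPower-exists : Prime p → 0 < n → ∃[ a ] ExactPower p a n
exactPower-exists {p} {n} pp = <-rec (λ n → 0 < n → ∃[ a ] ExactPower p a n) step n
  where
  step : ∀ n → (∀ {m} → m < n → 0 < m → ∃[ a ] ExactPower p a m) → 0 < n → ∃[ a ] ExactPower p a n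
  step n rec n>0 with p ∣? n
  ... | no p∤n = 0 , n , sym (*-identityˡ n) , p∤n
  ... | yes (divides zero refl) = contradiction n>0 (<-irrefl refl)
  ... | yes (divides q@(suc _) refl) with rec (m<m*n q p (prime⇒>1 pp)) z<s
  ...   | a , r , q≡p^a*r , p∤r =
    suc a , r , trans (cong (_* p) q≡p^a*r) (trans (*-comm (p ^ a * r) p) (sym (*-assoc p (p ^ a) r))) , p∤r

exactPower-suc : Prime p → 0 < n → p ∣ n → ∃[ a ] ExactPower p (suc a) n
exactPower-suc {p} pp n>0 p∣n with exactPower-exists pp n>0
... | zero  , r , refl , p∤r = contradiction (subst (p ∣_) (*-identityˡ r) p∣n) p∤r
... | suc a , r , n≡ , p∤r   = a , r , n≡ , p∤r

exactPower⇒∣ : 1 ≤ a → ExactPower p a n → p ∣ n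
exactPower⇒∣ {suc a} {p} _ (r , refl , _) = ∣m⇒∣m*n r (m∣m*n (p ^ a))

p^i∣p^a*r⇒i≤a : ∀ i a → Prime p → ¬ p ∣ r → p ^ i ∣ p ^ a * r → i ≤ a
p^i∣p^a*r⇒i≤a {p} {r} i a pp p∤r p^i∣ with i ≤? a
... | yes i≤a = i≤a
... | no  i≰a = ⊥-elim (p∤r (*-cancelˡ-∣ (p ^ a) {{p^a≢0 a pp}}
                  (∣-trans (∣-reflexive (*-comm (p ^ a) p)) (∣-trans (^-monoʳ-∣ p (≰⇒> i≰a)) p^i∣))))

exactPower-unique : ∀ a b → Prime p → ¬ p ∣ r → ¬ p ∣ s → p ^ a * r ≡ p ^ b * s → a ≡ b × r ≡ s
exactPower-unique {p} {r} {s} a b pp p∤r p∤s eq =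
  a≡b , *-cancelˡ-≡ r s (p ^ a) {{p^a≢0 a pp}} (trans eq (cong (λ c → p ^ c * s) (sym a≡b)))
  where
  a≡b : a ≡ b
  a≡b = ≤-antisym (p^i∣p^a*r⇒i≤a a b pp p∤s (subst (p ^ a ∣_) eq (m∣m*n r)))
                  (p^i∣p^a*r⇒i≤a b a pp p∤r (subst (p ^ b ∣_) (sym eq) (m∣m*n s)))

∣p^a*r⇒split : ∀ a → Prime p → ¬ p ∣ r → d ∣ p ^ a * r →
               ∃[ i ] ∃[ e ] i ≤ a × e ∣ r × d ≡ p ^ i * e × ¬ p ∣ e
∣p^a*r⇒split {p} {r} {d} a pp p∤r d∣ with exactPower-exists pp (∣⇒>0 (p^a*r>0 a pp p∤r) d∣)
... | i , e , refl , p∤e = i , e , p^i∣p^a*r⇒i≤a i a pp p∤r (∣-trans (m∣m*n e) d∣) ,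
                           prime∤∧∣p^a*r⇒∣r a pp p∤e (∣-trans (n∣m*n (p ^ i)) d∣) , refl , p∤e

module _ {A B : Set} where

  private
    ∈-++-remove : ∀ xs {ys} {v u : B} → v ∈ xs ++ u ∷ ys → v ≢ u → v ∈ xs ++ ys
    ∈-++-remove xs v∈ v≢u with ∈-++⁻ xs v∈
    ... | inj₁ v∈xs         = ∈-++⁺ˡ v∈xs
    ... | inj₂ (here refl)  = ⊥-elim (v≢u refl)
    ... | inj₂ (there v∈ys) = ∈-++⁺ʳ xs v∈ys

  injection⇒length≤ : ∀ (f : A → B) {xs ys} → Unique xs → (∀ {x} → x ∈ xs → f x ∈ ys) →
                      (∀ {x y} → x ∈ xs → y ∈ xs → f x ≡ f y → x ≡ y) → length xs ≤ length ys
  injection⇒length≤ f {[]}     _            _    _   = z≤n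
  injection⇒length≤ f {x ∷ xs} (x∉xs ∷ uxs) into inj with ∈-∃++ (into (here refl))
  ... | ys₁ , ys₂ , refl = begin
    suc (length xs)                 ≤⟨ s≤s (injection⇒length≤ f uxs into′ inj′) ⟩
    suc (length (ys₁ ++ ys₂))       ≡⟨ cong suc (length-++ ys₁) ⟩
    suc (length ys₁ + length ys₂)   ≡⟨ +-suc (length ys₁) (length ys₂) ⟨
    length ys₁ + length (f x ∷ ys₂) ≡⟨ length-++ ys₁ ⟨
    length (ys₁ ++ f x ∷ ys₂)       ∎
    where
    open ≤-Reasoning
    into′ : ∀ {y} → y ∈ xs → f y ∈ ys₁ ++ ys₂
    into′ y∈xs = ∈-++-remove ys₁ (into (there y∈xs))
                   λ fy≡fx → All.lookup x∉xs y∈xs (inj (here refl) (there y∈xs) (sym fy≡fx))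
    inj′ : ∀ {y z} → y ∈ xs → z ∈ xs → f y ≡ f z → y ≡ z
    inj′ y∈ z∈ = inj (there y∈) (there z∈)

bijection⇒length≡ : ∀ {A B : Set} (f : A → B) (g : B → A) {xs ys} → Unique xs → Unique ys →
                    (∀ {x} → x ∈ xs → f x ∈ ys) → (∀ {x y} → x ∈ xs → y ∈ xs → f x ≡ f y → x ≡ y) →
                    (∀ {y} → y ∈ ys → g y ∈ xs) → (∀ {x y} → x ∈ ys → y ∈ ys → g x ≡ g y → x ≡ y) →
                    length xs ≡ length ys
bijection⇒length≡ f g uxs uys f-into f-inj g-into g-inj =
  ≤-antisym (injection⇒length≤ f uxs f-into f-inj) (injection⇒length≤ g uys g-into g-inj)

module _ {A : Set} where

  unique∧⊆⇒length≤ : ∀ {xs ys : List A} → Unique xs → xs ⊆ ys → length xs ≤ length ys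
  unique∧⊆⇒length≤ uxs xs⊆ys = injection⇒length≤ id uxs xs⊆ys λ _ _ x≡y → x≡y

  sameMembers⇒length≡ : ∀ {xs ys : List A} → Unique xs → Unique ys → xs ⊆ ys → ys ⊆ xs →
                        length xs ≡ length ys
  sameMembers⇒length≡ uxs uys xs⊆ys ys⊆xs =
    ≤-antisym (unique∧⊆⇒length≤ uxs xs⊆ys) (unique∧⊆⇒length≤ uys ys⊆xs)

  length-filter+∁ : ∀ {P : Pred A 0ℓ} (P? : Decidable P) xs →
                    length (filter P? xs) + length (filter (∁? P?) xs) ≡ length xs
  length-filter+∁ P? [] = refl
  length-filter+∁ P? (x ∷ xs) with P? x
  ... | yes _ = cong suc (length-filter+∁ P? xs)
  ... | no  _ = trans (+-suc _ _) (cong suc (length-filter+∁ P? xs))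

_≢?_ : ∀ x y → Dec (x ≢ y)
x ≢? y = ¬? (x ≟ y)

length-remove-∈ : ∀ {xs} c → Unique xs → c ∈ xs → suc (length (filter (_≢? c) xs)) ≡ length xs
length-remove-∈ {xs} c uxs c∈xs = sameMembers⇒length≡ (c∉ ∷ Unique.filter⁺ (_≢? c) uxs) uxs ⊆xs xs⊆
  where
  c∉ : All (c ≢_) (filter (_≢? c) xs)
  c∉ = All.tabulate λ x∈ → λ { refl → proj₂ (∈-filter⁻ (_≢? c) {xs = xs} x∈) refl }
  ⊆xs : c ∷ filter (_≢? c) xs ⊆ xs
  ⊆xs (here refl) = c∈xs
  ⊆xs (there x∈)  = proj₁ (∈-filter⁻ (_≢? c) {xs = xs} x∈)
  xs⊆ : xs ⊆ c ∷ filter (_≢? c) xs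
  xs⊆ {x} x∈ with x ≟ c
  ... | yes refl = here refl
  ... | no  x≢c  = there (∈-filter⁺ (_≢? c) x∈ x≢c)

length-remove-∉ : ∀ {xs} c → Unique xs → ¬ c ∈ xs → length (filter (_≢? c) xs) ≡ length xs
length-remove-∉ {xs} c uxs c∉xs = sameMembers⇒length≡ (Unique.filter⁺ (_≢? c) uxs) uxs
  (λ x∈ → proj₁ (∈-filter⁻ (_≢? c) {xs = xs} x∈)) (λ x∈ → ∈-filter⁺ (_≢? c) x∈ λ { refl → c∉xs x∈ })

divisors : ℕ → List ℕ
divisors n = filter (_∣? n) (upTo (suc n))

divisors-unique : ∀ n → Unique (divisors n)
divisors-unique n = Unique.filter⁺ (_∣? n) (Unique.upTo⁺ (suc n))

∈-divisors⁺ : 0 < n → d ∣ n → d ∈ divisors n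
∈-divisors⁺ {n} n>0 d∣n = ∈-filter⁺ (_∣? n) (∈-upTo⁺ (s≤s (∣⇒≤ {{>-nonZero n>0}} d∣n))) d∣n

∈-divisors⁻ : d ∈ divisors n → d ∣ n
∈-divisors⁻ {n = n} d∈ = proj₂ (∈-filter⁻ (_∣? n) {xs = upTo (suc n)} d∈)

τ : ℕ → ℕ
τ n = length (divisors n)

-- The divisors of P r, P = p^(a+1), split into the multiples P e of P and the divisors of p^a r.
τ-split : ∀ a → Prime p → ¬ p ∣ r → τ (p ^ suc a * r) ≡ τ r + τ (p ^ a * r)
τ-split {p} {r} a pp p∤r = begin
  τ (P * r)                                                   ≡⟨ length-filter+∁ (P ∣?_) (divisors (P * r)) ⟨
  length multiples + length (filter (∁? (P ∣?_)) (divisors (P * r))) ≡⟨ cong₂ _+_ |multiples| |others| ⟩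
  τ r + τ (p ^ a * r)                                         ∎
  where
  open ≡-Reasoning
  P = p ^ suc a
  instance _ = p^a≢0 (suc a) pp
  multiples = filter (P ∣?_) (divisors (P * r))
  |multiples| : length multiples ≡ τ r
  |multiples| = trans (sameMembers⇒length≡ (Unique.filter⁺ (P ∣?_) (divisors-unique (P * r)))
                         (Unique.map⁺ (*-cancelˡ-≡ _ _ P) (divisors-unique r)) ⊆P*divisors P*divisors⊆)
                      (length-map (P *_) (divisors r))
    where
    ⊆P*divisors : multiples ⊆ map (P *_) (divisors r)
    ⊆P*divisors x∈ with ∈-filter⁻ (P ∣?_) {xs = divisors (P * r)} x∈
    ... | x∈divisors , divides q refl = subst (_∈ map (P *_) (divisors r)) (*-comm P q)
      (∈-map⁺ (P *_) (∈-divisors⁺ (∤⇒>0 p∤r)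
        (*-cancelʳ-∣ P (subst (q * P ∣_) (*-comm P r) (∈-divisors⁻ x∈divisors)))))
    P*divisors⊆ : map (P *_) (divisors r) ⊆ multiples
    P*divisors⊆ y∈ with ∈-map⁻ (P *_) y∈
    ... | e , e∈ , refl =
      ∈-filter⁺ (P ∣?_) (∈-divisors⁺ (p^a*r>0 (suc a) pp p∤r) (*-monoʳ-∣ P (∈-divisors⁻ e∈))) (m∣m*n e)
  |others| : length (filter (∁? (P ∣?_)) (divisors (P * r))) ≡ τ (p ^ a * r)
  |others| = sameMembers⇒length≡ (Unique.filter⁺ (∁? (P ∣?_)) (divisors-unique (P * r)))
               (divisors-unique (p ^ a * r)) ⊆divisors divisors⊆
    where
    ⊆divisors : filter (∁? (P ∣?_)) (divisors (P * r)) ⊆ divisors (p ^ a * r)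
    ⊆divisors x∈ with ∈-filter⁻ (∁? (P ∣?_)) {xs = divisors (P * r)} x∈
    ... | x∈divisors , P∤x with ∣p^a*r⇒split (suc a) pp p∤r (∈-divisors⁻ x∈divisors)
    ... | i , e , i≤1+a , e∣r , refl , _ with i ≟ suc a
    ...   | yes refl  = ⊥-elim (P∤x (m∣m*n e))
    ...   | no  i≢1+a = ∈-divisors⁺ (p^a*r>0 a pp p∤r)
                          (*-pres-∣ (^-monoʳ-∣ p (≤-pred (≤∧≢⇒< i≤1+a i≢1+a))) e∣r)
    divisors⊆ : divisors (p ^ a * r) ⊆ filter (∁? (P ∣?_)) (divisors (P * r))
    divisors⊆ x∈ = ∈-filter⁺ (∁? (P ∣?_))
      (∈-divisors⁺ (p^a*r>0 (suc a) pp p∤r) (∣-trans (∈-divisors⁻ x∈) (*-monoˡ-∣ r (^-monoʳ-∣ p (n≤1+n a)))))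
      λ P∣x → <-irrefl refl (p^i∣p^a*r⇒i≤a (suc a) a pp p∤r (∣-trans P∣x (∈-divisors⁻ x∈)))

τ-p^a*r : ∀ a → Prime p → ¬ p ∣ r → τ (p ^ a * r) ≡ suc a * τ r
τ-p^a*r {r = r} zero    pp p∤r = trans (cong τ (*-identityˡ r)) (sym (+-identityʳ (τ r)))
τ-p^a*r {r = r} (suc a) pp p∤r = trans (τ-split a pp p∤r) (cong (τ r +_) (τ-p^a*r a pp p∤r))

τ-p^a : ∀ a → Prime p → τ (p ^ a) ≡ suc a
τ-p^a {p} a pp = begin
  τ (p ^ a)          ≡⟨ cong τ (*-identityʳ (p ^ a)) ⟨
  τ (p ^ a * 1)      ≡⟨ τ-p^a*r a pp (prime∤1 pp) ⟩
  suc a * 1          ≡⟨ *-identityʳ (suc a) ⟩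
  suc a              ∎
  where open ≡-Reasoning

1<n⇒2≤τ : 1 < n → 2 ≤ τ n
1<n⇒2≤τ {n} 1<n = unique∧⊆⇒length≤ ((<⇒≢ 1<n ∷ []) ∷ [] ∷ [])
  λ { (here refl) → ∈-divisors⁺ (<⇒≤ 1<n) (1∣ n) ; (there (here refl)) → ∈-divisors⁺ (<⇒≤ 1<n) ∣-refl }

IsProper : ℕ → ℕ → Set
IsProper n d = 1 < d × d < n × d ∣ n

properDivisors : ℕ → List ℕ
properDivisors n = filter (λ d → 1 <? d ×-dec d <? n) (divisors n)

properDivisors-unique : ∀ n → Unique (properDivisors n)
properDivisors-unique n = Unique.filter⁺ (λ d → 1 <? d ×-dec d <? n) (divisors-unique n)

∈-properDivisors⁺ : IsProper n d → d ∈ properDivisors n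
∈-properDivisors⁺ {n} (1<d , d<n , d∣n) =
  ∈-filter⁺ (λ d → 1 <? d ×-dec d <? n) (∈-divisors⁺ (<-trans z<s (<-trans 1<d d<n)) d∣n) (1<d , d<n)

∈-properDivisors⁻ : d ∈ properDivisors n → IsProper n d
∈-properDivisors⁻ {n = n} d∈ with ∈-filter⁻ (λ d → 1 <? d ×-dec d <? n) {xs = divisors n} d∈
... | d∈divisors , 1<d , d<n = 1<d , d<n , ∈-divisors⁻ d∈divisors

length-properDivisors : 1 < n → length (properDivisors n) + 2 ≡ τ n
length-properDivisors {n} 1<n =
  trans (cong (length (properDivisors n) +_) |1∷n∷[]|) (length-filter+∁ proper? (divisors n))
  where
  proper? = λ d → 1 <? d ×-dec d <? n
  n>0 = <⇒≤ 1<n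
  improper = filter (∁? proper?) (divisors n)
  ⊆1∷n : improper ⊆ 1 ∷ n ∷ []
  ⊆1∷n {d} d∈ with ∈-filter⁻ (∁? proper?) {xs = divisors n} d∈
  ... | d∈divisors , ¬proper with 1 <? d | d <? n
  ... | yes 1<d | yes d<n = ⊥-elim (¬proper (1<d , d<n))
  ... | yes _   | no  d≮n =
    there (here (≤-antisym (∣⇒≤ {{>-nonZero n>0}} (∈-divisors⁻ d∈divisors)) (≮⇒≥ d≮n)))
  ... | no  1≮d | _       = here (≤-antisym (≮⇒≥ 1≮d) (∣⇒>0 n>0 (∈-divisors⁻ d∈divisors)))
  |1∷n∷[]| : 2 ≡ length improper
  |1∷n∷[]| = sameMembers⇒length≡ ((<⇒≢ 1<n ∷ []) ∷ [] ∷ []) (Unique.filter⁺ (∁? proper?) (divisors-unique n))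
    (λ { (here refl)         → ∈-filter⁺ (∁? proper?) (∈-divisors⁺ n>0 (1∣ n)) (<-irrefl refl ∘ proj₁)
       ; (there (here refl)) → ∈-filter⁺ (∁? proper?) (∈-divisors⁺ n>0 ∣-refl) (<-irrefl refl ∘ proj₂) })
    ⊆1∷n

Edge : ℕ → ℕ → ℕ → Set
Edge n x y = x ≢ y × n ∣ x * y

edge? : ∀ n x y → Dec (Edge n x y)
edge? n x y = x ≢? y ×-dec n ∣? x * y

Edge-sym : Edge n x y → Edge n y x
Edge-sym {n} {x} {y} (x≢y , n∣xy) = x≢y ∘ sym , subst (n ∣_) (*-comm x y) n∣xy

∣-irrelevant : 0 < d → (d∣n d∣n′ : d ∣ n) → d∣n ≡ d∣n′
∣-irrelevant {suc d} _ (divides q eq) (divides q′ eq′) with *-cancelʳ-≡ q q′ (suc d) (trans (sym eq) eq′)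
... | refl = cong (divides q) (≡-irrelevant eq eq′)

IsProper-irrelevant : (pd pd′ : IsProper n d) → pd ≡ pd′
IsProper-irrelevant (1<d , d<n , d∣n) (1<d′ , d<n′ , d∣n′) = cong₂ _,_ (<-irrelevant 1<d 1<d′)
  (cong₂ _,_ (<-irrelevant d<n d<n′) (∣-irrelevant (<⇒≤ 1<d) d∣n d∣n′))

properDivisor-≡ : {u v : ProperDivisor n} → proj₁ u ≡ proj₁ v → u ≡ v
properDivisor-≡ {u = d , pd} {.d , pd′} refl = cong (d ,_) (IsProper-irrelevant pd pd′)

record DivisorGraphIso (m n : ℕ) : Set where
  field
    to from     : ℕ → ℕ
    to-proper   : IsProper m x → IsProper n (to x)
    from-proper : IsProper n y → IsProper m (from y)
    from∘to     : IsProper m x → from (to x) ≡ x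
    to∘from     : IsProper n y → to (from y) ≡ y
    to-edge     : IsProper m x → IsProper m y → Edge m x y → Edge n (to x) (to y)
    from-edge   : IsProper m x → IsProper m y → Edge n (to x) (to y) → Edge m x y

  to-injective : IsProper m x → IsProper m y → to x ≡ to y → x ≡ y
  to-injective px py tx≡ty = trans (sym (from∘to px)) (trans (cong from tx≡ty) (from∘to py))

  from-injective : IsProper n x → IsProper n y → from x ≡ from y → x ≡ y
  from-injective px py fx≡fy = trans (sym (to∘from px)) (trans (cong to fx≡fy) (to∘from py))

open DivisorGraphIso

iso-sym : DivisorGraphIso m n → DivisorGraphIso n m
iso-sym I = record
  { to = from I ; from = to I ; to-proper = from-proper I ; from-proper = to-proper I
  ; from∘to = to∘from I ; to∘from = from∘to I
  ; to-edge = λ px py e → from-edge I (from-proper I px) (from-proper I py)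
                            (subst₂ (Edge _) (sym (to∘from I px)) (sym (to∘from I py)) e)
  ; from-edge = λ px py e → subst₂ (Edge _) (to∘from I px) (to∘from I py)
                              (to-edge I (from-proper I px) (from-proper I py) e) }

≅Υ⇒iso : m ≅Υ n → DivisorGraphIso m n
≅Υ⇒iso {m} {n} (f , f-edge) = record
  { to = to′ ; from = from′ ; to-proper = to′-proper ; from-proper = from′-proper
  ; from∘to = from∘to′ ; to∘from = to∘from′
  ; to-edge = λ {x} {y} px py e → subst₂ (Edge n) (sym (to′-spec px)) (sym (to′-spec py))
                                    (Equivalence.to (f-edge (x , px) (y , py)) e)
  ; from-edge = λ {x} {y} px py e → Equivalence.from (f-edge (x , px) (y , py))
                                      (subst₂ (Edge n) (to′-spec px) (to′-spec py) e) }
  where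
  proper? : ∀ n d → Dec (IsProper n d)
  proper? n d = 1 <? d ×-dec d <? n ×-dec d ∣? n
  f⁻¹ : ProperDivisor n → ProperDivisor m
  f⁻¹ y = proj₁ (Bijection.surjective f y)
  f∘f⁻¹ : ∀ y → Bijection.to f (f⁻¹ y) ≡ y
  f∘f⁻¹ y = proj₂ (Bijection.surjective f y) refl
  to′ from′ : ℕ → ℕ
  to′ x with proper? m x
  ... | yes px = proj₁ (Bijection.to f (x , px))
  ... | no  _  = 0
  from′ y with proper? n y
  ... | yes py = proj₁ (f⁻¹ (y , py))
  ... | no  _  = 0
  to′-spec : (px : IsProper m x) → to′ x ≡ proj₁ (Bijection.to f (x , px))
  to′-spec {x} px with proper? m x
  ... | yes px′ = cong (λ px → proj₁ (Bijection.to f (x , px))) (IsProper-irrelevant px′ px)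
  ... | no  ¬px = contradiction px ¬px
  from′-spec : (py : IsProper n y) → from′ y ≡ proj₁ (f⁻¹ (y , py))
  from′-spec {y} py with proper? n y
  ... | yes py′ = cong (λ py → proj₁ (f⁻¹ (y , py))) (IsProper-irrelevant py′ py)
  ... | no  ¬py = contradiction py ¬py
  to′-proper : IsProper m x → IsProper n (to′ x)
  to′-proper {x} px = subst (IsProper n) (sym (to′-spec px)) (proj₂ (Bijection.to f (x , px)))
  from′-proper : IsProper n y → IsProper m (from′ y)
  from′-proper {y} py = subst (IsProper m) (sym (from′-spec py)) (proj₂ (f⁻¹ (y , py)))
  from∘to′ : IsProper m x → from′ (to′ x) ≡ x
  from∘to′ px = trans (from′-spec (to′-proper px))
    (cong proj₁ (Bijection.injective f (trans (f∘f⁻¹ _) (properDivisor-≡ (to′-spec px)))))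
  to∘from′ : IsProper n y → to′ (from′ y) ≡ y
  to∘from′ {y} py = trans (to′-spec (from′-proper py)) (cong proj₁
    (trans (cong (Bijection.to f) (properDivisor-≡ {v = f⁻¹ (y , py)} (from′-spec py))) (f∘f⁻¹ (y , py))))

iso⇒≅Υ : DivisorGraphIso m n → m ≅Υ n
iso⇒≅Υ {m} {n} I = bijection , λ (x , px) (y , py) → mk⇔ (to-edge I px py) (from-edge I px py)
  where
  bijection : ProperDivisor m ⤖ ProperDivisor n
  bijection = record
    { to = λ (x , px) → to I x , to-proper I px
    ; cong = λ { refl → refl }
    ; bijective = (λ { {x , px} {y , py} eq → properDivisor-≡ (to-injective I px py (cong proj₁ eq)) })
                , λ (y , py) → (from I y , from-proper I py) , λ { refl → properDivisor-≡ (to∘from I py) } }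

neighbours : ℕ → ℕ → List ℕ
neighbours n x = filter (edge? n x) (properDivisors n)

neighbours-unique : ∀ n x → Unique (neighbours n x)
neighbours-unique n x = Unique.filter⁺ (edge? n x) (properDivisors-unique n)

∈-neighbours⁺ : IsProper n y → Edge n x y → y ∈ neighbours n x
∈-neighbours⁺ {n} {x = x} py e = ∈-filter⁺ (edge? n x) (∈-properDivisors⁺ py) e

∈-neighbours⁻ : y ∈ neighbours n x → IsProper n y × Edge n x y
∈-neighbours⁻ {n = n} {x} y∈ with ∈-filter⁻ (edge? n x) {xs = properDivisors n} y∈
... | y∈V , e = ∈-properDivisors⁻ y∈V , e

degree : ℕ → ℕ → ℕ
degree n x = length (neighbours n x)

iso-|properDivisors| : DivisorGraphIso m n → length (properDivisors m) ≡ length (properDivisors n)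
iso-|properDivisors| {m} {n} I = bijection⇒length≡ (to I) (from I)
  (properDivisors-unique m) (properDivisors-unique n)
  (λ x∈ → ∈-properDivisors⁺ (to-proper I (∈-properDivisors⁻ x∈)))
  (λ x∈ y∈ → to-injective I (∈-properDivisors⁻ x∈) (∈-properDivisors⁻ y∈))
  (λ y∈ → ∈-properDivisors⁺ (from-proper I (∈-properDivisors⁻ y∈)))
  (λ x∈ y∈ → from-injective I (∈-properDivisors⁻ x∈) (∈-properDivisors⁻ y∈))

iso-τ : 1 < m → 1 < n → DivisorGraphIso m n → τ m ≡ τ n
iso-τ {m} {n} 1<m 1<n I = begin
  τ m                              ≡⟨ length-properDivisors 1<m ⟨
  length (properDivisors m) + 2    ≡⟨ cong (_+ 2) (iso-|properDivisors| I) ⟩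
  length (properDivisors n) + 2    ≡⟨ length-properDivisors 1<n ⟩
  τ n                              ∎
  where open ≡-Reasoning

iso-degree : (I : DivisorGraphIso m n) → IsProper m x → degree m x ≡ degree n (to I x)
iso-degree {m} {n} {x} I px = bijection⇒length≡ (to I) (from I)
  (neighbours-unique m x) (neighbours-unique n (to I x))
  (λ y∈ → let py , e = ∈-neighbours⁻ y∈ in ∈-neighbours⁺ (to-proper I py) (to-edge I px py e))
  (λ y∈ z∈ → to-injective I (proj₁ (∈-neighbours⁻ y∈)) (proj₁ (∈-neighbours⁻ z∈)))
  (λ y∈ → let py , e = ∈-neighbours⁻ y∈ in ∈-neighbours⁺ (from-proper I py)
            (from-edge I px (from-proper I py) (subst (Edge n (to I x)) (sym (to∘from I py)) e)))
  (λ y∈ z∈ → from-injective I (proj₁ (∈-neighbours⁻ y∈)) (proj₁ (∈-neighbours⁻ z∈)))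

-- Leaves

IsLeaf : ℕ → ℕ → ℕ → Set
IsLeaf n u w = IsProper n u × IsProper n w × Edge n u w × (∀ {y} → IsProper n y → Edge n u y → y ≡ w)

iso-leaf : (I : DivisorGraphIso m n) → IsLeaf m u w → IsLeaf n (to I u) (to I w)
iso-leaf {n = n} {u} {w} I (pu , pw , e , unique) =
  to-proper I pu , to-proper I pw , to-edge I pu pw e , unique′
  where
  unique′ : IsProper n y → Edge n (to I u) y → y ≡ to I w
  unique′ {y} py e′ = trans (sym (to∘from I py)) (cong (to I) (unique (from-proper I py)
    (from-edge I pu (from-proper I py) (subst (Edge n (to I u)) (sym (to∘from I py)) e′))))

prime-leaf : Prime p → 1 < c → c ≢ p → IsLeaf (p * c) p c
prime-leaf {p} {c} pp 1<c c≢p =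
  (prime⇒>1 pp , m<m*n p c 1<c , m∣m*n c) ,
  (1<c , m<n*m c p {{>-nonZero (<⇒≤ 1<c)}} (prime⇒>1 pp) , n∣m*n p) ,
  (c≢p ∘ sym , ∣-refl) ,
  unique
  where
  instance _ = prime⇒nonZero pp
  unique : IsProper (p * c) y → Edge (p * c) p y → y ≡ c
  unique (_ , y<pc , y∣pc) (_ , pc∣py) with *-cancelˡ-∣ p pc∣py
  ... | divides k refl with prime⇒irreducible pp (*-cancelʳ-∣ {k} {p} c {{>-nonZero (<⇒≤ 1<c)}} y∣pc)
  ...   | inj₁ refl = *-identityˡ c
  ...   | inj₂ refl = contradiction y<pc (<-irrefl refl)

prime-leaf-p^1+a*r : ∀ a → Prime p → m ≡ p ^ suc a * r → ¬ p ∣ r → 1 < r → IsLeaf m p (p ^ a * r)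
prime-leaf-p^1+a*r {p} {r = r} a pp refl p∤r 1<r =
  subst (λ m → IsLeaf m p (p ^ a * r)) (sym (*-assoc p (p ^ a) r)) (prime-leaf pp 1<c c≢p)
  where
  1<c : 1 < p ^ a * r
  1<c = <-≤-trans 1<r (m≤n*m r (p ^ a) {{p^a≢0 a pp}})
  c≢p : p ^ a * r ≢ p
  c≢p c≡p with prime⇒irreducible pp (divides (p ^ a) (sym c≡p))
  ... | inj₁ refl = <-irrefl refl 1<r
  ... | inj₂ refl = p∤r ∣-refl

two-of-three : x ≡ u ⊎ x ≡ w → y ≡ u ⊎ y ≡ w → z ≡ u ⊎ z ≡ w → x ≡ y ⊎ y ≡ z ⊎ x ≡ z
two-of-three (inj₁ refl) (inj₁ refl) _           = inj₁ refl
two-of-three (inj₂ refl) (inj₂ refl) _           = inj₁ refl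
two-of-three (inj₁ refl) (inj₂ refl) (inj₁ refl) = inj₂ (inj₂ refl)
two-of-three (inj₁ refl) (inj₂ refl) (inj₂ refl) = inj₂ (inj₁ refl)
two-of-three (inj₂ refl) (inj₁ refl) (inj₁ refl) = inj₂ (inj₁ refl)
two-of-three (inj₂ refl) (inj₁ refl) (inj₂ refl) = inj₂ (inj₂ refl)

-- Writing m = c u, every c k with k a proper divisor of u is adjacent to u, so it is u or the
-- unique neighbour w; hence u has no chain of divisors 1 < k < j < u.
leaf-classification : IsLeaf m u w →
                      Prime u ⊎ ∃[ s ] Prime s × u ≡ s ^ 2 × (m ≡ s ^ 3 ⊎ m ≡ s ^ 4)
leaf-classification {m} {u} {w} ((1<u , u<m , divides c m≡cu) , _ , _ , unique) with prime? u
... | yes pu = inj₁ pu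
... | no ¬pu with ¬prime⇒composite {{n>1⇒nonTrivial 1<u}} ¬pu
... | composite {a} a<u (divides b u≡ba) = inj₂ (a , prime-a , u≡a² , shape)
  where
  1<c : 1 < c
  1<c = quotient>1 (divides c m≡cu) u<m
  instance _ = >-nonZero (<⇒≤ 1<c)
  multiple-of-c : k ∣ u → 0 < k → k < u → c * k ≡ u ⊎ c * k ≡ w
  multiple-of-c {k} k∣u k>0 k<u with c * k ≟ u
  ... | yes ck≡u = inj₁ ck≡u
  ... | no  ck≢u =
    inj₂ (unique proper (ck≢u ∘ sym , divides k (trans (x∙yz≈z∙yx u c k) (cong (k *_) (sym m≡cu)))))
    where
    proper : IsProper m (c * k)
    proper = ≤-trans 1<c (m≤m*n c k {{>-nonZero k>0}}) ,
             subst (c * k <_) (sym m≡cu) (*-monoʳ-< c k<u) ,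
             subst (c * k ∣_) (sym m≡cu) (*-monoʳ-∣ c k∣u)
  no-chain : 1 < k → k < j → k ∣ u → j ∣ u → j < u → ⊥
  no-chain {k} {j} 1<k k<j k∣u j∣u j<u with
    two-of-three (multiple-of-c (1∣ u) z<s 1<u) (multiple-of-c k∣u (<⇒≤ 1<k) (<-trans k<j j<u))
                 (multiple-of-c j∣u (<-trans (<⇒≤ 1<k) k<j) j<u)
  ... | inj₁ c1≡ck        = <⇒≢ (*-monoʳ-< c 1<k) c1≡ck
  ... | inj₂ (inj₁ ck≡cj) = <⇒≢ (*-monoʳ-< c k<j) ck≡cj
  ... | inj₂ (inj₂ c1≡cj) = <⇒≢ (*-monoʳ-< c (<-trans 1<k k<j)) c1≡cj
  1<a : 1 < a
  1<a = nonTrivial⇒n>1 a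
  1<b : 1 < b
  1<b = quotient>1 (divides b u≡ba) a<u
  a∣u : a ∣ u
  a∣u = divides b u≡ba
  b∣u : b ∣ u
  b∣u = divides a (trans u≡ba (*-comm b a))
  b<u : b < u
  b<u = subst (b <_) (sym u≡ba) (m<m*n b a {{>-nonZero (<⇒≤ 1<b)}} 1<a)
  a≡b : a ≡ b
  a≡b with <-cmp a b
  ... | tri< a<b _ _ = ⊥-elim (no-chain 1<a a<b a∣u b∣u b<u)
  ... | tri≈ _ a≡b _ = a≡b
  ... | tri> _ _ b<a = ⊥-elim (no-chain 1<b b<a b∣u a∣u a<u)
  u≡aa : u ≡ a * a
  u≡aa = trans u≡ba (cong (_* a) (sym a≡b))
  u≡a² : u ≡ a ^ 2
  u≡a² = trans u≡aa (cong (a *_) (sym (*-identityʳ a)))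
  prime-a : Prime a
  prime-a with prime? a
  ... | yes pa = pa
  ... | no ¬pa with ¬prime⇒composite ¬pa
  ... | composite {x} x<a x∣a = ⊥-elim (no-chain (nonTrivial⇒n>1 x) x<a (∣-trans x∣a a∣u) a∣u a<u)
  shape : m ≡ a ^ 3 ⊎ m ≡ a ^ 4
  shape with multiple-of-c (1∣ u) z<s 1<u
  ... | inj₁ c1≡u = inj₂ (begin
    m          ≡⟨ m≡cu ⟩
    c * u      ≡⟨ cong₂ _*_ (trans (sym (*-identityʳ c)) (trans c1≡u u≡a²)) u≡a² ⟩
    a ^ 2 * a ^ 2 ≡⟨ ^-distribˡ-+-* a 2 2 ⟨
    a ^ 4      ∎)
    where open ≡-Reasoning
  ... | inj₂ c1≡w with multiple-of-c a∣u (<⇒≤ 1<a) a<u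
  ...   | inj₁ ca≡u =
    inj₁ (trans m≡cu (cong₂ _*_ (*-cancelʳ-≡ c a a {{>-nonZero (<⇒≤ 1<a)}} (trans ca≡u u≡aa)) u≡a²))
  ...   | inj₂ ca≡w = ⊥-elim (<⇒≢ (*-monoʳ-< c 1<a) (trans c1≡w (sym ca≡w)))

IsPrimePower : ℕ → Set
IsPrimePower n = ∃[ p ] ∃[ a ] Prime p × n ≡ p ^ suc a

HasTwoPrimeFactors : ℕ → Set
HasTwoPrimeFactors n = ∃[ p ] ∃[ q ] Prime p × Prime q × p ≢ q × p ∣ n × q ∣ n

primePower⊎twoPrimes : 1 < n → IsPrimePower n ⊎ HasTwoPrimeFactors n
primePower⊎twoPrimes {n} 1<n with primeFactor 1<n
... | p , pp , p∣n with exactPower-suc pp (<⇒≤ 1<n) p∣n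
... | a , r , n≡ , p∤r with 1 <? r
...   | no  1≮r = inj₁ (p , a , pp , trans n≡ (trans (cong (p ^ suc a *_) r≡1) (*-identityʳ _)))
  where r≡1 = ≤-antisym (≮⇒≥ 1≮r) (∤⇒>0 p∤r)
...   | yes 1<r with primeFactor 1<r
...     | q , pq , q∣r = inj₂ (p , q , pp , pq , (λ { refl → p∤r q∣r }) , p∣n ,
                               subst (q ∣_) (sym n≡) (∣n⇒∣m*n (p ^ suc a) q∣r))

primePower-leaf : Prime p → m ≡ p ^ suc a → IsLeaf m u w → u ≡ p ⊎ (m ≡ p ^ 3 ⊎ m ≡ p ^ 4)
primePower-leaf {p} {a = a} pp m≡ leaf@((_ , _ , u∣m) , _) with leaf-classification leaf
... | inj₁ pu = inj₁ (prime∣prime^⇒≡ (suc a) pu pp (subst (_ ∣_) m≡ u∣m))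
... | inj₂ (s , ps , u≡s² , m≡s³⊎s⁴)
  with prime∣prime^⇒≡ (suc a) ps pp (subst (s ∣_) m≡ (∣-trans (subst (s ∣_) (sym u≡s²) (m∣m*n (s * 1))) u∣m))
... | refl = inj₂ m≡s³⊎s⁴

twoPrimes⇒≢p^ : ∀ k → HasTwoPrimeFactors n → Prime s → n ≢ s ^ k
twoPrimes⇒≢p^ k (p , q , pp , pq , p≢q , p∣n , q∣n) ps refl =
  p≢q (trans (prime∣prime^⇒≡ k pp ps p∣n) (sym (prime∣prime^⇒≡ k pq ps q∣n)))

twoPrimes⇒cofactor>1 : ∀ a → HasTwoPrimeFactors n → Prime p → n ≡ p ^ a * r → ¬ p ∣ r → 1 < r
twoPrimes⇒cofactor>1 {p = p} {r} a two pp n≡ p∤r with 1 <? r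
... | yes 1<r = 1<r
... | no  1≮r = ⊥-elim (twoPrimes⇒≢p^ a two pp (trans n≡ (trans (cong (p ^ a *_) r≡1) (*-identityʳ _))))
  where r≡1 = ≤-antisym (≮⇒≥ 1≮r) (∤⇒>0 p∤r)

twoPrimes⇒split : 0 < n → HasTwoPrimeFactors n → Prime p → p ∣ n →
                  ∃[ a ] ∃[ r ] n ≡ p ^ suc a * r × ¬ p ∣ r × 1 < r
twoPrimes⇒split n>0 two pp p∣n with exactPower-suc pp n>0 p∣n
... | a , r , n≡ , p∤r = a , r , n≡ , p∤r , twoPrimes⇒cofactor>1 (suc a) two pp n≡ p∤r

twoPrimes⇒prime-proper : 0 < n → HasTwoPrimeFactors n → Prime p → p ∣ n → IsProper n p
twoPrimes⇒prime-proper {n} {p} n>0 two pp p∣n =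
  prime⇒>1 pp ,
  ≤∧≢⇒< (∣⇒≤ {{>-nonZero n>0}} p∣n) (λ p≡n → twoPrimes⇒≢p^ 1 two pp (trans (sym p≡n) (sym (*-identityʳ p)))) ,
  p∣n

twoPrimes-prime-leaf : 1 < n → HasTwoPrimeFactors n → Prime q → q ∣ n → ∃[ c ] IsLeaf n q c
twoPrimes-prime-leaf 1<n two pq q∣n with twoPrimes⇒split (<⇒≤ 1<n) two pq q∣n
... | b , s , n≡ , q∤s , 1<s = _ , prime-leaf-p^1+a*r b pq n≡ q∤s 1<s

twoPrimes-leaf⇒prime : HasTwoPrimeFactors n → IsLeaf n u w → Prime u
twoPrimes-leaf⇒prime two leaf with leaf-classification leaf
... | inj₁ pu                       = pu
... | inj₂ (s , ps , _ , inj₁ n≡s³) = ⊥-elim (twoPrimes⇒≢p^ 3 two ps n≡s³)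
... | inj₂ (s , ps , _ , inj₂ n≡s⁴) = ⊥-elim (twoPrimes⇒≢p^ 4 two ps n≡s⁴)

-- Degrees

-- The neighbours of c in Υ(p c) are the multiples p e with e ∣ c, e ≠ c, except c itself.
degree-p*c : Prime p → 0 < c →
             (p ∣ c → suc (suc (degree (p * c) c)) ≡ τ c) × (¬ p ∣ c → suc (degree (p * c) c) ≡ τ c)
degree-p*c {p} {c} pp c>0 =
  (λ p∣c → trans (cong (suc ∘ suc) degree≡) (trans (cong suc (length-remove-∈ c uW (c∈W p∣c))) suc|W|≡τc)) ,
  (λ p∤c → trans (cong suc degree≡) (trans (cong suc (length-remove-∉ c uW (c∉W p∤c))) suc|W|≡τc))
  where
  instance
    _ = prime⇒nonZero pp
    _ = >-nonZero c>0
  W = filter (p ∣?_) (properDivisors (p * c))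
  uW : Unique W
  uW = Unique.filter⁺ (p ∣?_) (properDivisors-unique (p * c))
  c∈W : p ∣ c → c ∈ W
  c∈W p∣c = ∈-filter⁺ (p ∣?_)
    (∈-properDivisors⁺ (≤-trans (prime⇒>1 pp) (∣⇒≤ p∣c) , m<n*m c p (prime⇒>1 pp) , n∣m*n p)) p∣c
  c∉W : ¬ p ∣ c → ¬ c ∈ W
  c∉W p∤c c∈ = p∤c (proj₂ (∈-filter⁻ (p ∣?_) {xs = properDivisors (p * c)} c∈))
  cofactors = filter (_≢? c) (divisors c)
  u[p*cofactors] : Unique (map (p *_) cofactors)
  u[p*cofactors] = Unique.map⁺ (*-cancelˡ-≡ _ _ p) (Unique.filter⁺ (_≢? c) (divisors-unique c))
  W⊆ : W ⊆ map (p *_) cofactors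
  W⊆ y∈ with ∈-filter⁻ (p ∣?_) {xs = properDivisors (p * c)} y∈
  ... | y∈V , divides q refl with ∈-properDivisors⁻ y∈V
  ... | _ , qp<pc , qp∣pc = subst (_∈ map (p *_) cofactors) (*-comm p q) (∈-map⁺ (p *_)
          (∈-filter⁺ (_≢? c) {xs = divisors c}
            (∈-divisors⁺ c>0 (*-cancelʳ-∣ p (subst (q * p ∣_) (*-comm p c) qp∣pc)))
            λ { refl → <-irrefl (*-comm c p) qp<pc }))
  ⊆W : map (p *_) cofactors ⊆ W
  ⊆W y∈ with ∈-map⁻ (p *_) y∈
  ... | e , e∈ , refl with ∈-filter⁻ (_≢? c) {xs = divisors c} e∈
  ... | e∈divisors , e≢c = ∈-filter⁺ (p ∣?_) (∈-properDivisors⁺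
          ( ≤-trans (prime⇒>1 pp) (m≤m*n p e {{>-nonZero (∣⇒>0 c>0 e∣c)}})
          , *-monoʳ-< p (≤∧≢⇒< (∣⇒≤ e∣c) e≢c)
          , *-monoʳ-∣ p e∣c)) (m∣m*n e)
    where e∣c = ∈-divisors⁻ e∈divisors
  suc|W|≡τc : suc (length W) ≡ τ c
  suc|W|≡τc = begin
    suc (length W)                      ≡⟨ cong suc (sameMembers⇒length≡ uW u[p*cofactors] W⊆ ⊆W) ⟩
    suc (length (map (p *_) cofactors)) ≡⟨ cong suc (length-map (p *_) cofactors) ⟩
    suc (length cofactors)              ≡⟨ length-remove-∈ c (divisors-unique c) (∈-divisors⁺ c>0 ∣-refl) ⟩
    τ c                                 ∎
    where open ≡-Reasoning
  degree≡ : degree (p * c) c ≡ length (filter (_≢? c) W)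
  degree≡ = sameMembers⇒length≡ (neighbours-unique (p * c) c) (Unique.filter⁺ (_≢? c) uW)
    (λ y∈ → let py , c≢y , pc∣cy = ∈-neighbours⁻ y∈ in
      ∈-filter⁺ (_≢? c) (∈-filter⁺ (p ∣?_) (∈-properDivisors⁺ py)
        (*-cancelʳ-∣ c (subst (p * c ∣_) (*-comm c _) pc∣cy))) (c≢y ∘ sym))
    (λ y∈ → let y∈W , y≢c = ∈-filter⁻ (_≢? c) {xs = W} y∈
                y∈V , p∣y = ∈-filter⁻ (p ∣?_) {xs = properDivisors (p * c)} y∈W in
      ∈-neighbours⁺ (∈-properDivisors⁻ y∈V) (y≢c ∘ sym , subst (p * c ∣_) (*-comm _ c) (*-monoˡ-∣ c p∣y)))

-- The degree k of p^a r in Υ(p^(a+1) r), where D = τ r: by degree-p*c, k = τ(p^a r) − 1 − [a > 0],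
-- and τ(p^a r) = (a + 1) D.
CofactorDegree : ℕ → ℕ → ℕ → Set
CofactorDegree zero    D k = suc k ≡ D
CofactorDegree (suc a) D k = suc (suc k) ≡ suc (suc a) * D

cofactorDegree : ∀ a → Prime p → ¬ p ∣ r → CofactorDegree a (τ r) (degree (p ^ suc a * r) (p ^ a * r))
cofactorDegree {p} {r} a pp p∤r =
  subst (λ m → CofactorDegree a (τ r) (degree m (p ^ a * r))) (sym (*-assoc p (p ^ a) r)) (by-cases a)
  where
  by-cases : ∀ a → CofactorDegree a (τ r) (degree (p * (p ^ a * r)) (p ^ a * r))
  by-cases zero    = trans (proj₂ (degree-p*c pp (p^a*r>0 0 pp p∤r)) (p∤r ∘ subst (p ∣_) (*-identityˡ r)))
                           (trans (τ-p^a*r 0 pp p∤r) (*-identityˡ (τ r)))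
  by-cases (suc a) = trans (proj₁ (degree-p*c pp (p^a*r>0 (suc a) pp p∤r)) (∣m⇒∣m*n r (m∣m*n (p ^ a))))
                           (τ-p^a*r (suc a) pp p∤r)

private
  *≡2 : ∀ a D → 2 ≤ D → suc a * D ≡ 2 → a ≡ 0 × D ≡ 2
  *≡2 zero    D _   D+0≡2 = refl , trans (sym (+-identityʳ D)) D+0≡2
  *≡2 (suc a) D 2≤D eq    =
    contradiction eq (>⇒≢ (≤-trans (n≤1+n 3) (+-mono-≤ 2≤D (≤-trans 2≤D (m≤m+n D (a * D))))))

  -- k = D′ − 1 = (a + 2) D − 2 forces D′ = D + 1 and then (a + 1) D = 2.
  anomaly : ∀ a {D D′ k} → 2 ≤ D → suc (suc (suc a)) * D ≡ 2 * D′ →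
            suc (suc k) ≡ suc (suc a) * D → suc k ≡ D′ → suc (suc (suc a)) * D ≡ 6
  anomaly a {D} {D′} {k} 2≤D 3+a*D≡2D′ k+2≡ k+1≡D′ with *≡2 a D 2≤D (+-cancelˡ-≡ D _ _ D+[1+a]D≡D+2)
    where
    open ≡-Reasoning
    2+a*D≡1+D′ : suc (suc a) * D ≡ suc D′
    2+a*D≡1+D′ = trans (sym k+2≡) (cong suc k+1≡D′)
    1+D≡D′ : suc D ≡ D′
    1+D≡D′ = +-cancelʳ-≡ D′ (suc D) D′ (begin
      suc D + D′              ≡⟨ +-suc D D′ ⟨
      D + suc D′              ≡⟨ cong (D +_) 2+a*D≡1+D′ ⟨
      suc (suc (suc a)) * D   ≡⟨ 3+a*D≡2D′ ⟩
      D′ + (D′ + 0)           ≡⟨ cong (D′ +_) (+-identityʳ D′) ⟩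
      D′ + D′                 ∎)
    D+[1+a]D≡D+2 : D + suc a * D ≡ D + 2
    D+[1+a]D≡D+2 = trans 2+a*D≡1+D′ (trans (cong suc (sym 1+D≡D′)) (+-comm 2 D))
  ... | refl , refl = refl

cofactorDegree-injective : ∀ a b {D D′ k} → 2 ≤ D → 2 ≤ D′ → suc (suc a) * D ≡ suc (suc b) * D′ →
                           CofactorDegree a D k → CofactorDegree b D′ k → a ≡ b ⊎ suc (suc a) * D ≡ 6
cofactorDegree-injective zero    zero    _   _    _  _   _    = inj₁ refl
cofactorDegree-injective (suc a) zero    2≤D _    eq deg deg′ = inj₂ (anomaly a 2≤D eq deg deg′)
cofactorDegree-injective zero    (suc b) _   2≤D′ eq deg deg′ =
  inj₂ (trans eq (anomaly b 2≤D′ (sym eq) deg′ deg))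
cofactorDegree-injective (suc a) (suc b) {D} {D′} {k} 2≤D _ eq deg deg′ =
  inj₁ (suc-injective (*-cancelʳ-≡ _ _ D {{>-nonZero (<⇒≤ 2≤D)}}
    (trans (sym deg) (trans deg′ (cong (suc (suc b) *_) (sym D≡D′))))))
  where
  D≡D′ : D ≡ D′
  D≡D′ = +-cancelʳ-≡ (suc (suc k)) D D′ (trans (cong (D +_) deg) (trans eq (cong (D′ +_) (sym deg′))))

-- p is a leaf of Υ m with neighbour p^a r, so p′ = to p is a leaf of Υ n, hence prime, and to sends
-- p^a r to the neighbour p′^b s of p′; comparing the degrees of these neighbours gives a = b unless
-- τ m = 6.
iso-exactPower : 1 < m → 1 < n → (I : DivisorGraphIso m n) → HasTwoPrimeFactors n →
                 Prime p → m ≡ p ^ suc a * r → ¬ p ∣ r → 1 < r →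
                 Prime (to I p) × (ExactPower (to I p) (suc a) n ⊎ τ m ≡ 6)
iso-exactPower {m} {n} {p} {a} {r} 1<m 1<n I twoₙ pp m≡ p∤r 1<r = pp′ , exponent
  where
  leafₘ = prime-leaf-p^1+a*r a pp m≡ p∤r 1<r
  leafₙ = iso-leaf I leafₘ
  p′ = to I p
  pp′ : Prime p′
  pp′ = twoPrimes-leaf⇒prime twoₙ leafₙ
  exponent : ExactPower p′ (suc a) n ⊎ τ m ≡ 6
  exponent with twoPrimes⇒split (<⇒≤ 1<n) twoₙ pp′ (proj₂ (proj₂ (proj₁ leafₙ)))
  ... | b , s , n≡ , p′∤s , 1<s with cofactorDegree-injective a b (1<n⇒2≤τ 1<r) (1<n⇒2≤τ 1<s) τ≡ degₘ degₙ
    where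
    τ≡ : suc (suc a) * τ r ≡ suc (suc b) * τ s
    τ≡ = begin
      suc (suc a) * τ r    ≡⟨ τ-p^a*r (suc a) pp p∤r ⟨
      τ (p ^ suc a * r)    ≡⟨ cong τ m≡ ⟨
      τ m                  ≡⟨ iso-τ 1<m 1<n I ⟩
      τ n                  ≡⟨ cong τ n≡ ⟩
      τ (p′ ^ suc b * s)   ≡⟨ τ-p^a*r (suc b) pp′ p′∤s ⟩
      suc (suc b) * τ s    ∎
      where open ≡-Reasoning
    neighbourₙ : p′ ^ b * s ≡ to I (p ^ a * r)
    neighbourₙ = proj₂ (proj₂ (proj₂ leafₙ)) (proj₁ (proj₂ leafp′)) (proj₁ (proj₂ (proj₂ leafp′)))
      where leafp′ = prime-leaf-p^1+a*r b pp′ n≡ p′∤s 1<s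
    degₘ : CofactorDegree a (τ r) (degree m (p ^ a * r))
    degₘ = subst (λ m → CofactorDegree a (τ r) (degree m (p ^ a * r))) (sym m≡) (cofactorDegree a pp p∤r)
    degₙ : CofactorDegree b (τ s) (degree m (p ^ a * r))
    degₙ = subst (CofactorDegree b (τ s))
             (trans (cong (degree n) neighbourₙ) (sym (iso-degree I (proj₁ (proj₂ leafₘ)))))
             (subst (λ n → CofactorDegree b (τ s) (degree n (p′ ^ b * s))) (sym n≡)
               (cofactorDegree b pp′ p′∤s))
  ... | inj₁ refl     = inj₁ (s , n≡ , p′∤s)
  ... | inj₂ 2+a*τr≡6 = inj₂ (trans (cong τ m≡) (trans (τ-p^a*r (suc a) pp p∤r) 2+a*τr≡6))

twoPrimes⇒4≤τ : 1 < n → HasTwoPrimeFactors n → 4 ≤ τ n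
twoPrimes⇒4≤τ {n} 1<n two@(p , _ , pp , _ , _ , p∣n , _) with twoPrimes⇒split (<⇒≤ 1<n) two pp p∣n
... | a , r , n≡ , p∤r , 1<r = subst (4 ≤_) (sym (trans (cong τ n≡) (τ-p^a*r (suc a) pp p∤r)))
                                 (*-mono-≤ {2} {suc (suc a)} (s≤s (s≤s z≤n)) (1<n⇒2≤τ 1<r))

τ<4⇒primePower : 1 < n → τ n < 4 → ∃[ p ] ∃[ a ] Prime p × n ≡ p ^ suc a × τ n ≡ suc (suc a)
τ<4⇒primePower 1<n τ<4 with primePower⊎twoPrimes 1<n
... | inj₁ (p , a , pp , refl) = p , a , pp , refl , τ-p^a (suc a) pp
... | inj₂ two                 = contradiction (twoPrimes⇒4≤τ 1<n two) (<⇒≱ τ<4)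

τ≡2⇒prime : 1 < n → τ n ≡ 2 → Prime n
τ≡2⇒prime 1<n τ≡2 with τ<4⇒primePower 1<n (subst (_< 4) (sym τ≡2) (s≤s (s≤s (s≤s z≤n))))
... | p , zero  , pp , refl , _ = subst Prime (sym (*-identityʳ p)) pp
... | p , suc a , pp , _ , τ≡   = contradiction (trans (sym τ≡) τ≡2) λ ()

τ≡3⇒square : 1 < n → τ n ≡ 3 → ∃[ p ] Prime p × n ≡ p ^ 2
τ≡3⇒square 1<n τ≡3 with τ<4⇒primePower 1<n (subst (_< 4) (sym τ≡3) (s≤s (s≤s (s≤s (s≤s z≤n)))))
... | p , suc zero    , pp , n≡ , _ = p , pp , n≡
... | p , zero        , pp , _ , τ≡ = contradiction (trans (sym τ≡) τ≡3) λ ()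
... | p , suc (suc a) , pp , _ , τ≡ = contradiction (trans (sym τ≡) τ≡3) λ ()

2+b*D<6 : ∀ b D → 2 ≤ D → suc (suc b) * D < 6 → b ≡ 0 × D ≡ 2
2+b*D<6 zero    1                   (s≤s ()) _
2+b*D<6 zero    2                   _   _  = refl , refl
2+b*D<6 zero    (suc (suc (suc D))) _   <6 = contradiction (*-monoʳ-≤ 2 {3} (s≤s (s≤s (s≤s z≤n)))) (<⇒≱ <6)
2+b*D<6 (suc b) D                   2≤D <6 =
  contradiction (*-mono-≤ {3} {suc (suc (suc b))} (s≤s (s≤s (s≤s z≤n))) 2≤D) (<⇒≱ <6)

IsP²Q : ℕ → Set
IsP²Q n = ∃[ p ] ∃[ q ] Prime p × Prime q × p ≢ q × n ≡ p ^ 2 * q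

τ≡6⇒p²q : 1 < n → HasTwoPrimeFactors n → τ n ≡ 6 → IsP²Q n
τ≡6⇒p²q {n} 1<n two@(p , _ , pp , _ , _ , p∣n , _) τ≡6 with twoPrimes⇒split (<⇒≤ 1<n) two pp p∣n
... | a , r , n≡ , p∤r , 1<r = shape a n≡ (trans (sym (τ-p^a*r (suc a) pp p∤r)) (trans (cong τ (sym n≡)) τ≡6))
  where
  shape : ∀ a → n ≡ p ^ suc a * r → suc (suc a) * τ r ≡ 6 → IsP²Q n
  shape zero n≡ 2τr≡6 with τ≡3⇒square 1<r (*-cancelˡ-≡ (τ r) 3 2 2τr≡6)
  ... | s , ps , refl = s , p , ps , pp , (λ { refl → p∤r (m∣m*n (s * 1)) }) ,
                        trans n≡ (trans (cong (_* s ^ 2) (*-identityʳ p)) (*-comm p (s ^ 2)))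
  shape (suc zero) n≡ 3τr≡6 =
    p , r , pp , τ≡2⇒prime 1<r (*-cancelˡ-≡ (τ r) 2 3 3τr≡6) , (λ { refl → p∤r ∣-refl }) , n≡
  shape (suc (suc a)) n≡ τ≡ = contradiction τ≡ (>⇒≢ (≤-trans (n≤1+n 7)
    (*-mono-≤ {4} {suc (suc (suc (suc a)))} (s≤s (s≤s (s≤s (s≤s z≤n)))) (1<n⇒2≤τ 1<r))))

twoPrimes∧τ<6⇒semiprime : 1 < n → HasTwoPrimeFactors n → τ n < 6 →
                          τ n ≡ 4 × ∃[ q₁ ] ∃[ q₂ ] Prime q₁ × Prime q₂ × q₁ ≢ q₂ × n ≡ q₁ * q₂
twoPrimes∧τ<6⇒semiprime {n} 1<n two@(q , _ , pq , _ , _ , q∣n , _) τn<6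
  with twoPrimes⇒split (<⇒≤ 1<n) two pq q∣n
... | b , s , n≡ , q∤s , 1<s with 2+b*D<6 b (τ s) (1<n⇒2≤τ 1<s) (subst (_< 6) τn≡ τn<6)
  where
  τn≡ : τ n ≡ suc (suc b) * τ s
  τn≡ = trans (cong τ n≡) (τ-p^a*r (suc b) pq q∤s)
... | refl , τs≡2 = trans (trans (cong τ n≡) (τ-p^a*r 1 pq q∤s)) (cong (2 *_) τs≡2) ,
                    q , s , pq , τ≡2⇒prime 1<s τs≡2 , (λ { refl → q∤s ∣-refl }) ,
                    trans n≡ (cong (_* s) (*-identityʳ q))

exactPower-*ˡ⁺ : ∀ a → Prime p → Prime q → q ≢ p → ExactPower q b r → ExactPower q b (p ^ a * r)
exactPower-*ˡ⁺ {p} {q} {b} a pp pq q≢p (t , refl , q∤t) =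
  p ^ a * t , x∙yz≈y∙xz (p ^ a) (q ^ b) t , prime∤* pq (λ q∣p^a → q≢p (prime∣prime^⇒≡ a pq pp q∣p^a)) q∤t

exactPower-*ˡ⁻ : ∀ a → Prime p → Prime q → q ≢ p → ExactPower q b (p ^ a * r) → ExactPower q b r
exactPower-*ˡ⁻ {p} {q} {b} {r} a pp pq q≢p (t , p^a*r≡q^b*t , q∤t)
  with prime∤∧∣p^a*r⇒∣r a pp (λ p∣q^b → q≢p (sym (prime∣prime^⇒≡ b pp pq p∣q^b)))
         (divides t (trans p^a*r≡q^b*t (*-comm (q ^ b) t)))
... | divides k refl = k , *-comm k (q ^ b) , λ q∣k → q∤t (subst (q ∣_) p^a*k≡t (∣n⇒∣m*n (p ^ a) q∣k))
  where
  p^a*k≡t : p ^ a * k ≡ t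
  p^a*k≡t = *-cancelˡ-≡ _ _ (q ^ b) {{p^a≢0 b pq}}
              (trans (x∙yz≈y∙xz (q ^ b) (p ^ a) k) (trans (cong (p ^ a *_) (*-comm (q ^ b) k)) p^a*r≡q^b*t))

power : ℕ × ℕ → ℕ
power (p , a) = p ^ a

ExactPrimePower : ℕ → ℕ × ℕ → Set
ExactPrimePower n (p , a) = Prime p × 1 ≤ a × ExactPower p a n

record ExactFactorisation (n : ℕ) (fs : List (ℕ × ℕ)) : Set where
  field
    exact    : All (ExactPrimePower n) fs
    distinct : AllPairs (λ (p , _) (q , _) → p ≢ q) fs
    complete : Prime q → q ∣ n → q ∈ map proj₁ fs

open ExactFactorisation

exactFactorisation-exists : 0 < n → ∃ (ExactFactorisation n)
exactFactorisation-exists {n} = <-rec (λ n → 0 < n → ∃ (ExactFactorisation n)) step n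
  where
  step : ∀ n → (∀ {m} → m < n → 0 < m → ∃ (ExactFactorisation m)) → 0 < n → ∃ (ExactFactorisation n)
  step n rec n>0 with 1 <? n
  ... | no 1≮n = [] , record
    { exact = [] ; distinct = []
    ; complete = λ pq q∣n → ⊥-elim (prime∤1 pq (subst (_ ∣_) (≤-antisym (≮⇒≥ 1≮n) n>0) q∣n)) }
  ... | yes 1<n with primeFactor 1<n
  ... | p , pp , p∣n with exactPower-suc pp n>0 p∣n
  ... | a , r , n≡ , p∤r
    with rec (subst (r <_) (sym n≡) (m<n*m r _ {{>-nonZero (∤⇒>0 p∤r)}} (1<p^1+a a pp))) (∤⇒>0 p∤r)
  ... | fs , F = (p , suc a) ∷ fs , record
    { exact    = (pp , s≤s z≤n , r , n≡ , p∤r) ∷ All.map lift (exact F)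
    ; distinct = All.map (λ qbe p≡q → ≢p qbe (sym p≡q)) (exact F) ∷ distinct F
    ; complete = complete′ }
    where
    ≢p : ∀ {qb} → ExactPrimePower r qb → proj₁ qb ≢ p
    ≢p (_ , 1≤b , e) refl = p∤r (exactPower⇒∣ 1≤b e)
    lift : ∀ {qb} → ExactPrimePower r qb → ExactPrimePower n qb
    lift {q , b} qbe@(pq , 1≤b , e) =
      pq , 1≤b , subst (ExactPower q b) (sym n≡) (exactPower-*ˡ⁺ {b = b} (suc a) pp pq (≢p qbe) e)
    complete′ : Prime q → q ∣ n → q ∈ p ∷ map proj₁ fs
    complete′ {q} pq q∣n with q ≟ p
    ... | yes refl = here refl
    ... | no  q≢p  = there (complete F pq (prime∤∧∣p^a*r⇒∣r (suc a) pp
                       (λ p∣q → q≢p (sym (prime∣prime⇒≡ pp pq p∣q))) (subst (q ∣_) n≡ q∣n)))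

exactFactorisation-tail : ExactFactorisation n ((q , b) ∷ fs) → n ≡ q ^ b * r → ¬ q ∣ r →
                          ExactFactorisation r fs
exactFactorisation-tail {n} {q} {b} {fs} {r} F n≡ q∤r = record
  { exact    = All.zipWith lower (AllPairs.head (distinct F) , All.tail (exact F))
  ; distinct = AllPairs.tail (distinct F)
  ; complete = complete′ }
  where
  pq = proj₁ (All.head (exact F))
  lower : ∀ {pa} → q ≢ proj₁ pa × ExactPrimePower n pa → ExactPrimePower r pa
  lower {p , a} (q≢p , pp , 1≤a , e) =
    pp , 1≤a , exactPower-*ˡ⁻ {b = a} b pq pp (q≢p ∘ sym) (subst (ExactPower p a) n≡ e)
  complete′ : Prime p → p ∣ r → p ∈ map proj₁ fs
  complete′ {p} pp p∣r with complete F pp (subst (p ∣_) (sym n≡) (∣n⇒∣m*n (q ^ b) p∣r))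
  ... | here refl = contradiction p∣r q∤r
  ... | there p∈  = p∈

exactFactorisation⇒product : 0 < n → ExactFactorisation n fs → product (map power fs) ≡ n
exactFactorisation⇒product {n} {[]} n>0 F with 1 <? n
... | yes 1<n = let _ , pp , p∣n = primeFactor 1<n in contradiction (complete F pp p∣n) λ ()
... | no  1≮n = ≤-antisym n>0 (≮⇒≥ 1≮n)
exactFactorisation⇒product {n} {(q , b) ∷ fs} n>0 F with All.head (exact F)
... | _ , _ , r , n≡ , q∤r = trans (cong (q ^ b *_)
        (exactFactorisation⇒product (∤⇒>0 q∤r) (exactFactorisation-tail F n≡ q∤r))) (sym n≡)

exactFactorisation-↭ : fs ↭ gs → ExactFactorisation n fs → ExactFactorisation n gs
exactFactorisation-↭ σ F = record
  { exact    = ↭.All-resp-↭ σ (exact F)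
  ; distinct = ↭ₛ.AllPairs-resp-↭ (setoid (ℕ × ℕ)) (_∘ sym) (resp₂ _) (↭⇒↭ₛ σ) (distinct F)
  ; complete = λ pq q∣n → ↭.∈-resp-↭ (↭.map⁺ proj₁ σ) (complete F pq q∣n) }

DescendingExponents : List (ℕ × ℕ) → Set
DescendingExponents = AllPairs (λ pa qb → proj₂ pa ≥ proj₂ qb)

byDescendingExponent : DecTotalOrder 0ℓ 0ℓ 0ℓ
byDescendingExponent = On.decTotalOrder (Flip.decTotalOrder ≤-decTotalOrder) (proj₂ {A = ℕ} {B = λ _ → ℕ})

sortedExactFactorisation-exists : 0 < n → ∃[ fs ] ExactFactorisation n fs × DescendingExponents fs
sortedExactFactorisation-exists n>0 with exactFactorisation-exists n>0
... | fs , F = sort fs , exactFactorisation-↭ (↭-sym (sort-↭ fs)) F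
             , Sorted.Sorted⇒AllPairs (DecTotalOrder.totalOrder byDescendingExponent) (sort-↗ fs)
  where open import Data.List.Sort byDescendingExponent using (sort; sort-↭; sort-↗)

exactFactorisation⇒isFactorization : 0 < n → ExactFactorisation n fs → DescendingExponents fs →
                                     IsFactorization n fs
exactFactorisation⇒isFactorization n>0 F descending =
  All.map proj₁ (exact F) , distinct F , All.map (proj₁ ∘ proj₂) (exact F) , descending ,
  exactFactorisation⇒product n>0 F

primePower-factorisation : Prime p → IsFactorization (p ^ suc a) ((p , suc a) ∷ [])
primePower-factorisation pp = (pp ∷ []) , ([] ∷ []) , (s≤s z≤n ∷ []) , ([] ∷ []) , *-identityʳ _

p²q-factorisation : Prime p → Prime q → p ≢ q → IsFactorization (p ^ 2 * q) ((p , 2) ∷ (q , 1) ∷ [])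
p²q-factorisation {p} {q} pp pq p≢q =
  (pp ∷ pq ∷ []) , ((p≢q ∷ []) ∷ [] ∷ []) , (s≤s z≤n ∷ s≤s z≤n ∷ []) , ((s≤s z≤n ∷ []) ∷ [] ∷ []) ,
  cong (p ^ 2 *_) (trans (*-identityʳ (q * 1)) (*-identityʳ q))

-- From an isomorphism to similarity

p²q-similar : IsP²Q m → IsP²Q n → Similar m n
p²q-similar (p , q , pp , pq , p≢q , refl) (p′ , q′ , pp′ , pq′ , p′≢q′ , refl) =
  _ , _ , p²q-factorisation pp pq p≢q , p²q-factorisation pp′ pq′ p′≢q′ , refl

iso-primePowers⇒similar : 1 < m → 1 < n → DivisorGraphIso m n → IsPrimePower m → IsPrimePower n →
                          Similar m n
iso-primePowers⇒similar 1<m 1<n I (p , a , pp , refl) (q , b , pq , refl)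
  with suc-injective (trans (sym (τ-p^a (suc a) pp)) (trans (iso-τ 1<m 1<n I) (τ-p^a (suc b) pq)))
... | refl = _ , _ , primePower-factorisation {a = a} pp , primePower-factorisation {a = a} pq , refl

-- A sorted exact factorisation of m is carried along `to` to one of n with the same exponents.
iso-twoPrimes⇒similar : 1 < m → 1 < n → DivisorGraphIso m n → HasTwoPrimeFactors m → HasTwoPrimeFactors n →
                        Similar m n
iso-twoPrimes⇒similar {m} {n} 1<m 1<n I twoₘ twoₙ with τ m ≟ 6
... | yes τm≡6 = p²q-similar (τ≡6⇒p²q 1<m twoₘ τm≡6) (τ≡6⇒p²q 1<n twoₙ (trans (sym (iso-τ 1<m 1<n I)) τm≡6))
... | no  τm≢6 with sortedExactFactorisation-exists (<⇒≤ 1<m)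
... | fs , F , descending =
  fs , map relabel fs ,
  exactFactorisation⇒isFactorization (<⇒≤ 1<m) F descending ,
  exactFactorisation⇒isFactorization (<⇒≤ 1<n) G (AllPairs.map⁺ descending) ,
  map-∘ {g = proj₂} {f = relabel} fs
  where
  relabel : ℕ × ℕ → ℕ × ℕ
  relabel (p , a) = to I p , a
  relabel-exact : ∀ {pa} → ExactPrimePower m pa → ExactPrimePower n (relabel pa)
  relabel-exact {p , suc a} (pp , 1≤a , r , m≡ , p∤r) =
    exponent (iso-exactPower {a = a} 1<m 1<n I twoₙ pp m≡ p∤r (twoPrimes⇒cofactor>1 (suc a) twoₘ pp m≡ p∤r))
    where
    exponent : Prime (to I p) × (ExactPower (to I p) (suc a) n ⊎ τ m ≡ 6) → ExactPrimePower n (to I p , suc a)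
    exponent (pp′ , inj₁ exact′) = pp′ , 1≤a , exact′
    exponent (_   , inj₂ τm≡6)   = contradiction τm≡6 τm≢6
  proper : ∀ {pa} → ExactPrimePower m pa → IsProper m (proj₁ pa)
  proper (pp , 1≤a , e) = twoPrimes⇒prime-proper (<⇒≤ 1<m) twoₘ pp (exactPower⇒∣ 1≤a e)
  relabel-distinct : ∀ {fs} → All (ExactPrimePower m) fs → AllPairs (λ (p , _) (q , _) → p ≢ q) fs →
                     AllPairs (λ (p , _) (q , _) → p ≢ q) (map relabel fs)
  relabel-distinct []       []               = []
  relabel-distinct (e ∷ es) (≢s ∷ distinct′) =
    All.map⁺ (All.zipWith (λ (p≢q , e′) → p≢q ∘ to-injective I (proper e) (proper e′)) (≢s , es)) ∷
    relabel-distinct es distinct′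
  G : ExactFactorisation n (map relabel fs)
  G = record
    { exact    = All.gmap⁺ relabel-exact (exact F)
    ; distinct = relabel-distinct (exact F) (distinct F)
    ; complete = complete′ }
    where
    complete′ : Prime q → q ∣ n → q ∈ map proj₁ (map relabel fs)
    complete′ {q} pq q∣n with twoPrimes-prime-leaf 1<n twoₙ pq q∣n
    ... | _ , leaf = subst (_∈ map proj₁ (map relabel fs)) (to∘from I (proj₁ leaf))
      (subst (to I (from I q) ∈_) (trans (sym (map-∘ fs)) (map-∘ fs))
        (∈-map⁺ (to I) (complete F (twoPrimes-leaf⇒prime twoₘ leafₘ) (proj₂ (proj₂ (proj₁ leafₘ))))))
      where leafₘ = iso-leaf (iso-sym I) leaf

ExceptionalPair : ℕ → ℕ → Set
ExceptionalPair m n = ∃[ p ] ∃[ q₁ ] ∃[ q₂ ] Prime p × Prime q₁ × Prime q₂ × q₁ ≢ q₂ ×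
                        ((m ≡ p ^ 3 × n ≡ q₁ * q₂) ⊎ (m ≡ q₁ * q₂ × n ≡ p ^ 3))

exceptionalPair-sym : ExceptionalPair m n → ExceptionalPair n m
exceptionalPair-sym (p , q₁ , q₂ , pp , pq₁ , pq₂ , q₁≢q₂ , inj₁ (m≡ , n≡)) =
  p , q₁ , q₂ , pp , pq₁ , pq₂ , q₁≢q₂ , inj₂ (n≡ , m≡)
exceptionalPair-sym (p , q₁ , q₂ , pp , pq₁ , pq₂ , q₁≢q₂ , inj₂ (m≡ , n≡)) =
  p , q₁ , q₂ , pp , pq₁ , pq₂ , q₁≢q₂ , inj₁ (n≡ , m≡)

-- Two distinct primes of n are leaves of Υ n; their images are leaves of Υ m and cannot both be p.
iso-twoPrimes⇒p³⊎p⁴ : 1 < n → DivisorGraphIso m n → Prime p → m ≡ p ^ suc a → HasTwoPrimeFactors n →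
                      m ≡ p ^ 3 ⊎ m ≡ p ^ 4
iso-twoPrimes⇒p³⊎p⁴ {a = a} 1<n I pp m≡ two@(q₁ , q₂ , pq₁ , pq₂ , q₁≢q₂ , q₁∣n , q₂∣n)
  with twoPrimes-prime-leaf 1<n two pq₁ q₁∣n | twoPrimes-prime-leaf 1<n two pq₂ q₂∣n
... | _ , leaf₁ | _ , leaf₂
  with primePower-leaf {a = a} pp m≡ (iso-leaf (iso-sym I) leaf₁)
     | primePower-leaf {a = a} pp m≡ (iso-leaf (iso-sym I) leaf₂)
... | inj₂ m≡p³⊎p⁴ | _            = m≡p³⊎p⁴
... | inj₁ _       | inj₂ m≡p³⊎p⁴ = m≡p³⊎p⁴
... | inj₁ u₁≡p    | inj₁ u₂≡p    =
  ⊥-elim (q₁≢q₂ (from-injective I (proj₁ leaf₁) (proj₁ leaf₂) (trans u₁≡p (sym u₂≡p))))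

iso-primePower-twoPrimes : 1 < m → 1 < n → DivisorGraphIso m n → IsPrimePower m → HasTwoPrimeFactors n →
                           ExceptionalPair m n
iso-primePower-twoPrimes {m} {n} 1<m 1<n I (p , a , pp , m≡) two =
  cube (iso-twoPrimes⇒p³⊎p⁴ {a = a} 1<n I pp m≡ two)
  where
  τn≡ : ∀ k → m ≡ p ^ k → τ n ≡ suc k
  τn≡ k m≡p^k = trans (sym (iso-τ 1<m 1<n I)) (trans (cong τ m≡p^k) (τ-p^a k pp))
  cube : m ≡ p ^ 3 ⊎ m ≡ p ^ 4 → ExceptionalPair m n
  cube (inj₁ m≡p³) with twoPrimes∧τ<6⇒semiprime 1<n two (subst (_< 6) (sym (τn≡ 3 m≡p³)) (n≤1+n 5))
  ... | _ , q₁ , q₂ , pq₁ , pq₂ , q₁≢q₂ , n≡ = p , q₁ , q₂ , pp , pq₁ , pq₂ , q₁≢q₂ , inj₁ (m≡p³ , n≡)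
  cube (inj₂ m≡p⁴) with twoPrimes∧τ<6⇒semiprime 1<n two (subst (_< 6) (sym (τn≡ 4 m≡p⁴)) (n<1+n 5))
  ... | τn≡4 , _ = contradiction (trans (sym τn≡4) (τn≡ 4 m≡p⁴)) λ ()

iso⇒similar⊎exceptionalPair : 1 < m → 1 < n → DivisorGraphIso m n → Similar m n ⊎ ExceptionalPair m n
iso⇒similar⊎exceptionalPair 1<m 1<n I with primePower⊎twoPrimes 1<m | primePower⊎twoPrimes 1<n
... | inj₁ primePowerₘ | inj₁ primePowerₙ = inj₁ (iso-primePowers⇒similar 1<m 1<n I primePowerₘ primePowerₙ)
... | inj₁ primePowerₘ | inj₂ twoₙ        = inj₂ (iso-primePower-twoPrimes 1<m 1<n I primePowerₘ twoₙ)
... | inj₂ twoₘ        | inj₁ primePowerₙ =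
  inj₂ (exceptionalPair-sym (iso-primePower-twoPrimes 1<n 1<m (iso-sym I) primePowerₙ twoₘ))
... | inj₂ twoₘ        | inj₂ twoₙ        = inj₁ (iso-twoPrimes⇒similar 1<m 1<n I twoₘ twoₙ)

-- From similarity to an isomorphism

-- splitPower pp d = (i , e) with d = p^i e and p ∤ e; the value at d = 0 is junk.
splitPower : Prime p → ℕ → ℕ × ℕ
splitPower pp d with 0 <? d
... | yes d>0 = let a , r , _ = exactPower-exists pp d>0 in a , r
... | no  _   = 0 , 0

splitPower-p^i* : ∀ i (pp : Prime p) → ¬ p ∣ e → splitPower pp (p ^ i * e) ≡ (i , e)
splitPower-p^i* {p} {e} i pp p∤e with 0 <? p ^ i * e
... | no  ≯0      = contradiction (p^a*r>0 i pp p∤e) ≯0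
... | yes p^i*e>0 with exactPower-exists pp p^i*e>0
... | i′ , e′ , eq , p∤e′ with exactPower-unique i i′ pp p∤e p∤e′ eq
... | refl , refl = refl

replacePrime : Prime p → ℕ → (ℕ → ℕ) → ℕ → ℕ
replacePrime pp q Φ d = q ^ proj₁ (splitPower pp d) * Φ (proj₂ (splitPower pp d))

replacePrime-p^i* : ∀ (pp : Prime p) q Φ i → ¬ p ∣ e → replacePrime pp q Φ (p ^ i * e) ≡ q ^ i * Φ e
replacePrime-p^i* pp q Φ i p∤e rewrite splitPower-p^i* i pp p∤e = refl

p^i*x*p^j*y : ∀ p i j x y → (p ^ i * x) * (p ^ j * y) ≡ p ^ (i + j) * (x * y)
p^i*x*p^j*y p i j x y =
  trans (interchange (p ^ i) x (p ^ j) y) (cong (_* (x * y)) (sym (^-distribˡ-+-* p i j)))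

p^a*r∣p^k*s⇔ : ∀ a k → Prime p → ¬ p ∣ r → ¬ p ∣ s → p ^ a * r ∣ p ^ k * s ⇔ (a ≤ k × r ∣ s)
p^a*r∣p^k*s⇔ {p} {r} a k pp p∤r p∤s = mk⇔
  (λ ∣ → p^i∣p^a*r⇒i≤a a k pp p∤s (∣-trans (m∣m*n r) ∣) ,
         prime∤∧∣p^a*r⇒∣r k pp p∤r (∣-trans (n∣m*n (p ^ a)) ∣))
  (λ (a≤k , r∣s) → *-pres-∣ (^-monoʳ-∣ p a≤k) r∣s)

record DivisorMap (m n : ℕ) (Φ Ψ : ℕ → ℕ) : Set where
  field
    ∣-preserving : d ∣ m → Φ d ∣ n
    left-inverse : d ∣ m → Ψ (Φ d) ≡ d
    Φ[1]≡1       : Φ 1 ≡ 1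
    Φ[m]≡n       : Φ m ≡ n
    edge⁺        : d ∣ m → e ∣ m → m ∣ d * e → n ∣ Φ d * Φ e
    edge⁻        : d ∣ m → e ∣ m → n ∣ Φ d * Φ e → m ∣ d * e

  injective : d ∣ m → e ∣ m → Φ d ≡ Φ e → d ≡ e
  injective d∣m e∣m Φd≡Φe = trans (sym (left-inverse d∣m)) (trans (cong Ψ Φd≡Φe) (left-inverse e∣m))

divisorMap-id : DivisorMap 1 1 id id
divisorMap-id = record
  { ∣-preserving = id ; left-inverse = λ _ → refl ; Φ[1]≡1 = refl ; Φ[m]≡n = refl
  ; edge⁺ = λ _ _ → id ; edge⁻ = λ _ _ → id }

divisorMap-extend : ∀ a (pp : Prime p) (pq : Prime q) → ¬ p ∣ m → ¬ q ∣ n → DivisorMap m n Φ Ψ →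
                    DivisorMap (p ^ a * m) (q ^ a * n) (replacePrime pp q Φ) (replacePrime pq p Ψ)
divisorMap-extend {p} {q} {m} {n} {Φ} {Ψ} a pp pq p∤m q∤n M = record
  { ∣-preserving = ∣-preserving′ ; left-inverse = left-inverse′
  ; Φ[1]≡1 = trans (replacePrime-p^i* pp q Φ 0 (prime∤1 pp)) (trans (*-identityˡ (Φ 1)) M.Φ[1]≡1)
  ; Φ[m]≡n = trans (replacePrime-p^i* pp q Φ a p∤m) (cong (q ^ a *_) M.Φ[m]≡n)
  ; edge⁺ = edge⁺′ ; edge⁻ = edge⁻′ }
  where
  module M = DivisorMap M
  Φ̂ = replacePrime pp q Φ
  Ψ̂ = replacePrime pq p Ψ
  q∤Φ : d ∣ m → ¬ q ∣ Φ d
  q∤Φ d∣m q∣Φd = q∤n (∣-trans q∣Φd (M.∣-preserving d∣m))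
  Φ̂*Φ̂ : ∀ i j → ¬ p ∣ d → ¬ p ∣ e → Φ̂ (p ^ i * d) * Φ̂ (p ^ j * e) ≡ q ^ (i + j) * (Φ d * Φ e)
  Φ̂*Φ̂ {d} {e} i j p∤d p∤e =
    trans (cong₂ _*_ (replacePrime-p^i* pp q Φ i p∤d) (replacePrime-p^i* pp q Φ j p∤e))
          (p^i*x*p^j*y q i j (Φ d) (Φ e))
  ∣-preserving′ : d ∣ p ^ a * m → Φ̂ d ∣ q ^ a * n
  ∣-preserving′ d∣ with ∣p^a*r⇒split a pp p∤m d∣
  ... | i , d′ , i≤a , d′∣m , refl , p∤d′ = subst (_∣ q ^ a * n) (sym (replacePrime-p^i* pp q Φ i p∤d′))
                                               (*-pres-∣ (^-monoʳ-∣ q i≤a) (M.∣-preserving d′∣m))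
  left-inverse′ : d ∣ p ^ a * m → Ψ̂ (Φ̂ d) ≡ d
  left-inverse′ d∣ with ∣p^a*r⇒split a pp p∤m d∣
  ... | i , d′ , _ , d′∣m , refl , p∤d′ = begin
    Ψ̂ (Φ̂ (p ^ i * d′))       ≡⟨ cong Ψ̂ (replacePrime-p^i* pp q Φ i p∤d′) ⟩
    Ψ̂ (q ^ i * Φ d′)         ≡⟨ replacePrime-p^i* pq p Ψ i (q∤Φ d′∣m) ⟩
    p ^ i * Ψ (Φ d′)         ≡⟨ cong (p ^ i *_) (M.left-inverse d′∣m) ⟩
    p ^ i * d′               ∎
    where open ≡-Reasoning
  edge⁺′ : d ∣ p ^ a * m → e ∣ p ^ a * m → p ^ a * m ∣ d * e → q ^ a * n ∣ Φ̂ d * Φ̂ e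
  edge⁺′ d∣ e∣ ∣de with ∣p^a*r⇒split a pp p∤m d∣ | ∣p^a*r⇒split a pp p∤m e∣
  ... | i , d′ , _ , d′∣m , refl , p∤d′ | j , e′ , _ , e′∣m , refl , p∤e′
    with Equivalence.to (p^a*r∣p^k*s⇔ a (i + j) pp p∤m (prime∤* pp p∤d′ p∤e′))
           (subst (p ^ a * m ∣_) (p^i*x*p^j*y p i j d′ e′) ∣de)
  ... | a≤i+j , m∣d′e′ = subst (q ^ a * n ∣_) (sym (Φ̂*Φ̂ i j p∤d′ p∤e′))
          (Equivalence.from (p^a*r∣p^k*s⇔ a (i + j) pq q∤n (prime∤* pq (q∤Φ d′∣m) (q∤Φ e′∣m)))
            (a≤i+j , M.edge⁺ d′∣m e′∣m m∣d′e′))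
  edge⁻′ : d ∣ p ^ a * m → e ∣ p ^ a * m → q ^ a * n ∣ Φ̂ d * Φ̂ e → p ^ a * m ∣ d * e
  edge⁻′ d∣ e∣ ∣ΦdΦe with ∣p^a*r⇒split a pp p∤m d∣ | ∣p^a*r⇒split a pp p∤m e∣
  ... | i , d′ , _ , d′∣m , refl , p∤d′ | j , e′ , _ , e′∣m , refl , p∤e′
    with Equivalence.to (p^a*r∣p^k*s⇔ a (i + j) pq q∤n (prime∤* pq (q∤Φ d′∣m) (q∤Φ e′∣m)))
           (subst (q ^ a * n ∣_) (Φ̂*Φ̂ i j p∤d′ p∤e′) ∣ΦdΦe)
  ... | a≤i+j , n∣ΦdΦe = subst (p ^ a * m ∣_) (sym (p^i*x*p^j*y p i j d′ e′))
          (Equivalence.from (p^a*r∣p^k*s⇔ a (i + j) pp p∤m (prime∤* pp p∤d′ p∤e′))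
            (a≤i+j , M.edge⁻ d′∣m e′∣m n∣ΦdΦe))

prime∤product : Prime p → All (λ qb → p ≢ proj₁ qb) fs → All (λ qb → Prime (proj₁ qb)) fs →
                ¬ p ∣ product (map power fs)
prime∤product pp [] [] = prime∤1 pp
prime∤product {p} {(q , b) ∷ fs} pp (p≢q ∷ p≢fs) (pq ∷ pfs) p∣
  with euclidsLemma (q ^ b) (product (map power fs)) pp p∣
... | inj₁ p∣q^b  = p≢q (prime∣prime^⇒≡ b pp pq p∣q^b)
... | inj₂ p∣rest = prime∤product pp p≢fs pfs p∣rest

DivisorMaps : ℕ → ℕ → Set
DivisorMaps m n = ∃[ Φ ] ∃[ Ψ ] DivisorMap m n Φ Ψ × DivisorMap n m Ψ Φ

sameExponents⇒divisorMaps : ∀ fs gs →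
  All (λ pe → Prime (proj₁ pe)) fs → AllPairs (λ a b → proj₁ a ≢ proj₁ b) fs →
  All (λ pe → Prime (proj₁ pe)) gs → AllPairs (λ a b → proj₁ a ≢ proj₁ b) gs →
  map proj₂ fs ≡ map proj₂ gs → DivisorMaps (product (map power fs)) (product (map power gs))
sameExponents⇒divisorMaps [] [] _ _ _ _ _ = id , id , divisorMap-id , divisorMap-id
sameExponents⇒divisorMaps ((p , a) ∷ fs) ((q , b) ∷ gs) (pp ∷ pfs) (p≢fs ∷ dfs) (pq ∷ pgs) (q≢gs ∷ dgs) exps
  with ∷-injective exps
... | refl , exps′ with sameExponents⇒divisorMaps fs gs pfs dfs pgs dgs exps′
... | Φ , Ψ , M , M′ =
  replacePrime pp q Φ , replacePrime pq p Ψ ,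
  divisorMap-extend a pp pq p∤fs q∤gs M , divisorMap-extend a pq pp q∤gs p∤fs M′
  where
  p∤fs = prime∤product pp p≢fs pfs
  q∤gs = prime∤product pq q≢gs pgs

≢0∧≢1⇒>1 : x ≢ 0 → x ≢ 1 → 1 < x
≢0∧≢1⇒>1 {0}           x≢0 _   = contradiction refl x≢0
≢0∧≢1⇒>1 {1}           _   x≢1 = contradiction refl x≢1
≢0∧≢1⇒>1 {suc (suc x)} _   _   = s≤s (s≤s z≤n)

divisorMap-proper : 0 < n → DivisorMap m n Φ Ψ → IsProper m x → IsProper n (Φ x)
divisorMap-proper {n} {m} {Φ} {Ψ} {x} n>0 M (1<x , x<m , x∣m) =
  ≢0∧≢1⇒>1 Φx≢0 Φx≢1 , ≤∧≢⇒< (∣⇒≤ {{>-nonZero n>0}} Φx∣n) Φx≢n , Φx∣n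
  where
  module M = DivisorMap M
  Φx∣n = M.∣-preserving x∣m
  Φx≢0 : Φ x ≢ 0
  Φx≢0 Φx≡0 = >⇒≢ n>0 (0∣⇒≡0 (subst (_∣ n) Φx≡0 Φx∣n))
  Φx≢1 : Φ x ≢ 1
  Φx≢1 Φx≡1 = >⇒≢ 1<x (M.injective x∣m (1∣ m) (trans Φx≡1 (sym M.Φ[1]≡1)))
  Φx≢n : Φ x ≢ n
  Φx≢n Φx≡n = <⇒≢ x<m (M.injective x∣m ∣-refl (trans Φx≡n (sym M.Φ[m]≡n)))

divisorMaps⇒iso : 0 < m → 0 < n → DivisorMap m n Φ Ψ → DivisorMap n m Ψ Φ → DivisorGraphIso m n
divisorMaps⇒iso {m} {n} {Φ} {Ψ} m>0 n>0 M M′ = record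
  { to = Φ ; from = Ψ
  ; to-proper = divisorMap-proper n>0 M ; from-proper = divisorMap-proper m>0 M′
  ; from∘to = λ (_ , _ , x∣m) → M.left-inverse x∣m
  ; to∘from = λ (_ , _ , y∣n) → M′.left-inverse y∣n
  ; to-edge = λ (_ , _ , x∣m) (_ , _ , y∣m) (x≢y , m∣xy) → x≢y ∘ M.injective x∣m y∣m , M.edge⁺ x∣m y∣m m∣xy
  ; from-edge = λ (_ , _ , x∣m) (_ , _ , y∣m) (Φx≢Φy , n∣ΦxΦy) → Φx≢Φy ∘ cong Φ , M.edge⁻ x∣m y∣m n∣ΦxΦy }
  where
  module M  = DivisorMap M
  module M′ = DivisorMap M′

similar⇒≅Υ : 0 < m → 0 < n → Similar m n → m ≅Υ n
similar⇒≅Υ m>0 n>0 (fs , gs , (pfs , dfs , _ , _ , refl) , (pgs , dgs , _ , _ , refl) , exps)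
  with sameExponents⇒divisorMaps fs gs pfs dfs pgs dgs exps
... | _ , _ , M , M′ = iso⇒≅Υ (divisorMaps⇒iso m>0 n>0 M M′)

-- Divisor graphs with a single edge

SingleEdge : ℕ → ℕ → ℕ → Set
SingleEdge n x y = IsProper n x × IsProper n y × Edge n x y × (∀ {z} → IsProper n z → z ≡ x ⊎ z ≡ y)

singleEdge-edge : SingleEdge n x y → IsProper n u → IsProper n w → u ≢ w → Edge n u w
singleEdge-edge (_ , _ , e , vertex) pu pw u≢w with vertex pu | vertex pw
... | inj₁ refl | inj₁ refl = contradiction refl u≢w
... | inj₁ refl | inj₂ refl = e
... | inj₂ refl | inj₁ refl = Edge-sym e
... | inj₂ refl | inj₂ refl = contradiction refl u≢w

pick : ℕ → ℕ → ℕ → ℕ → ℕ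
pick x u w z with z ≟ x
... | yes _ = u
... | no  _ = w

pick-≡ : ∀ x u w → pick x u w x ≡ u
pick-≡ x u w with x ≟ x
... | yes _   = refl
... | no  x≢x = contradiction refl x≢x

pick-≢ : ∀ x u w → z ≢ x → pick x u w z ≡ w
pick-≢ {z} x u w z≢x with z ≟ x
... | yes z≡x = contradiction z≡x z≢x
... | no  _   = refl

singleEdge-iso : SingleEdge m x y → SingleEdge n u w → DivisorGraphIso m n
singleEdge-iso {m} {x} {y} {n} {u} {w} M@(px , py , (x≢y , _) , vertexₘ) N@(pu , pw , (u≢w , _) , vertexₙ) =
  record
  { to = pick x u w ; from = pick u x y
  ; to-proper = to-proper′ ; from-proper = from-proper′
  ; from∘to = from∘to′ ; to∘from = to∘from′
  ; to-edge = λ pz pz′ (z≢z′ , _) → singleEdge-edge N (to-proper′ pz) (to-proper′ pz′)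
      (z≢z′ ∘ λ tz≡tz′ → trans (sym (from∘to′ pz)) (trans (cong (pick u x y) tz≡tz′) (from∘to′ pz′)))
  ; from-edge = λ pz pz′ (tz≢tz′ , _) → singleEdge-edge M pz pz′ (tz≢tz′ ∘ cong (pick x u w)) }
  where
  to-x   = pick-≡ x u w
  to-y   = pick-≢ x u w (x≢y ∘ sym)
  from-u = pick-≡ u x y
  from-w = pick-≢ u x y (u≢w ∘ sym)
  to-proper′ : IsProper m z → IsProper n (pick x u w z)
  to-proper′ pz with vertexₘ pz
  ... | inj₁ refl = subst (IsProper n) (sym to-x) pu
  ... | inj₂ refl = subst (IsProper n) (sym to-y) pw
  from-proper′ : IsProper n z → IsProper m (pick u x y z)
  from-proper′ pz with vertexₙ pz
  ... | inj₁ refl = subst (IsProper m) (sym from-u) px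
  ... | inj₂ refl = subst (IsProper m) (sym from-w) py
  from∘to′ : IsProper m z → pick u x y (pick x u w z) ≡ z
  from∘to′ pz with vertexₘ pz
  ... | inj₁ refl = trans (cong (pick u x y) to-x) from-u
  ... | inj₂ refl = trans (cong (pick u x y) to-y) from-w
  to∘from′ : IsProper n z → pick x u w (pick u x y z) ≡ z
  to∘from′ pz with vertexₙ pz
  ... | inj₁ refl = trans (cong (pick x u w) from-u) to-x
  ... | inj₂ refl = trans (cong (pick x u w) from-w) to-y

properDivisor-p^a : ∀ a → Prime p → IsProper (p ^ a) y → ∃[ i ] y ≡ p ^ i × 0 < i × i < a
properDivisor-p^a {p} {y} a pp (1<y , y<p^a , y∣p^a)
  with ∣p^a*r⇒split a pp (prime∤1 pp) (subst (y ∣_) (sym (*-identityʳ (p ^ a))) y∣p^a)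
... | i , e , i≤a , e∣1 , y≡ , _ with ∣1⇒≡1 e∣1
... | refl = i , y≡p^i , n≢0⇒n>0 (λ i≡0 → >⇒≢ 1<y (trans y≡p^i (cong (p ^_) i≡0))) ,
             ≤∧≢⇒< i≤a λ { refl → <-irrefl y≡p^i y<p^a }
  where
  y≡p^i : y ≡ p ^ i
  y≡p^i = trans y≡ (*-identityʳ (p ^ i))

cube-singleEdge : Prime p → SingleEdge (p ^ 3) (p ^ 1) (p ^ 2)
cube-singleEdge {p} pp =
  proper z<s (s≤s (s≤s z≤n)) , proper z<s (s≤s (s≤s (s≤s z≤n))) ,
  (<⇒≢ (p^i<p^j (n<1+n 1)) , ∣-reflexive (^-distribˡ-+-* p 1 2)) , vertex
  where
  p^i<p^j : i < j → p ^ i < p ^ j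
  p^i<p^j = ^-monoʳ-< p (prime⇒>1 pp)
  proper : 0 < i → i < 3 → IsProper (p ^ 3) (p ^ i)
  proper 0<i i<3 = p^i<p^j 0<i , p^i<p^j i<3 , ^-monoʳ-∣ p (<⇒≤ i<3)
  vertex : IsProper (p ^ 3) z → z ≡ p ^ 1 ⊎ z ≡ p ^ 2
  vertex pz with properDivisor-p^a 3 pp pz
  ... | 1 , z≡p¹ , _ , _ = inj₁ z≡p¹
  ... | 2 , z≡p² , _ , _ = inj₂ z≡p²
  ... | suc (suc (suc _)) , _ , _ , s≤s (s≤s (s≤s ()))

semiprime-singleEdge : Prime q → Prime r → q ≢ r → SingleEdge (q * r) q r
semiprime-singleEdge {q} {r} pq pr q≢r =
  (1<q , m<m*n q r {{>-nonZero (prime⇒>0 pq)}} 1<r , m∣m*n r) ,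
  (1<r , m<n*m r q {{>-nonZero (prime⇒>0 pr)}} 1<q , n∣m*n q) ,
  (q≢r , ∣-refl) , vertex
  where
  1<q = prime⇒>1 pq
  1<r = prime⇒>1 pr
  vertex : IsProper (q * r) z → z ≡ q ⊎ z ≡ r
  vertex {z} (1<z , z<qr , z∣qr)
    with ∣p^a*r⇒split 1 pq (λ q∣r → q≢r (prime∣prime⇒≡ pq pr q∣r))
           (subst (z ∣_) (cong (_* r) (sym (*-identityʳ q))) z∣qr)
  ... | i , e , i≤1 , e∣r , refl , _ with i | prime⇒irreducible pr e∣r
  ... | 0 | inj₁ refl = contradiction refl (>⇒≢ 1<z)
  ... | 1 | inj₁ refl = inj₁ (trans (*-identityʳ (q * 1)) (*-identityʳ q))
  ... | 0 | inj₂ refl = inj₂ (+-identityʳ r)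
  ... | 1 | inj₂ refl = contradiction (cong (_* r) (*-identityʳ q)) (<⇒≢ z<qr)
  ... | suc (suc _) | _ = contradiction i≤1 λ { (s≤s ()) }

exceptionalPair⇒iso : ExceptionalPair m n → DivisorGraphIso m n
exceptionalPair⇒iso (p , q₁ , q₂ , pp , pq₁ , pq₂ , q₁≢q₂ , inj₁ (refl , refl)) =
  singleEdge-iso (cube-singleEdge pp) (semiprime-singleEdge pq₁ pq₂ q₁≢q₂)
exceptionalPair⇒iso (p , q₁ , q₂ , pp , pq₁ , pq₂ , q₁≢q₂ , inj₂ (refl , refl)) =
  singleEdge-iso (semiprime-singleEdge pq₁ pq₂ q₁≢q₂) (cube-singleEdge pp)

theorem3p1 : (m n : ℕ) → Composite m → Composite n →
    (m ≅Υ n) ⇔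
      (Similar m n ⊎
        (∃[ p ] ∃[ q₁ ] ∃[ q₂ ] Prime p × Prime q₁ × Prime q₂ × q₁ ≢ q₂ ×
          ((m ≡ p ^ 3 × n ≡ q₁ * q₂) ⊎ (m ≡ q₁ * q₂ × n ≡ p ^ 3))))
theorem3p1 m n composite-m composite-n = mk⇔
  (iso⇒similar⊎exceptionalPair 1<m 1<n ∘ ≅Υ⇒iso)
  [ similar⇒≅Υ (<⇒≤ 1<m) (<⇒≤ 1<n) , iso⇒≅Υ ∘ exceptionalPair⇒iso ]
  where
  1<m = nonTrivial⇒n>1 m {{composite⇒nonTrivial composite-m}}
  1<n = nonTrivial⇒n>1 n {{composite⇒nonTrivial composite-n}}
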